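{- Let $\Psi\in\{\mathfrak F,\mathfrak B\}$, let $\alpha,\beta$ satisfy $2<\alpha\le 3$ and $4\alpha-\beta=6$, and let $G\in\mathcal G(\Psi,\alpha,\beta)$. Then $G$ has no vertex cut $M$ with $G|_M$ isomorphic to the diamond $D=K_4\setminus e$.
   Context: All graphs are finite and simple. $|G|$ is the number of vertices, $e(G)$ the number of edges, $G|_X$ the subgraph induced on $X$. $q_{\alpha,\beta}(G)=\alpha|G|-e(G)-\beta$. $\mathfrak F$ is the class of forests and $\mathfrak B$ the class of bipartite graphs. A vertex cut is a vertex set whose removal disconnects the graph; a $\Psi$-cut of $G$ is a vertex cut $M$ with $G|_M\in\Psi$. $\mathcal G(\Psi,\alpha,\beta)$ is the set of graphs $G$ such that $|G|\ge4$, $q_{\alpha,\beta}(G)>0$, $G$ has no $\Psi$-cut, and $G$ has the smallest number of vertices among all graphs with these three properties. $K_4\setminus e$ is the complete graph on 4 vertices with one edge removed.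
   Formalization: The parameters α and β range over the rationals instead of the reals. -}

module Defs where

open import Data.Nat using (ℕ; zero; suc; _<ᵇ_; _≥_)
open import Data.Bool using (Bool; true; false; _∧_; T)
open import Data.Fin using (Fin; toℕ)
open import Data.List using (List; []; _∷_; length; filterᵇ; allFin; cartesianProduct; lookup)
open import Data.List.Membership.Propositional using (_∈_; _∉_)
open import Data.List.Relation.Unary.Unique.Propositional using (Unique)
open import Data.Product using (Σ; _×_; _,_; proj₁; proj₂; ∃)
open import Data.Empty using (⊥)
open import Data.Integer using (+_)
open import Data.Rational using (ℚ; _/_; _*_; _-_; 0ℚ; _<_)
open import Function.Bundles using (_↔_; Inverse)
open import Relation.Nullary using (¬_)
open import Relation.Binary.PropositionalEquality using (_≡_)

record Graph : Set where
  field
    n     : ℕ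
    E     : Fin n → Fin n → Bool
    sym   : ∀ i j → E i j ≡ E j i
    irrefl : ∀ i → E i i ≡ false
open Graph public

Adj : (G : Graph) → Fin (n G) → Fin (n G) → Set
Adj G i j = T (E G i j)

∣_∣ᵥ : Graph → ℕ
∣ G ∣ᵥ = n G

e : Graph → ℕ
e G = length (filterᵇ (λ p → (toℕ (proj₁ p) <ᵇ toℕ (proj₂ p)) ∧ E G (proj₁ p) (proj₂ p))
                      (cartesianProduct (allFin (n G)) (allFin (n G))))

ℕ→ℚ : ℕ → ℚ
ℕ→ℚ k = + k / 1

q : ℚ → ℚ → Graph → ℚ
q α β G = (α * ℕ→ℚ ∣ G ∣ᵥ - ℕ→ℚ (e G)) - β

induced : (G : Graph) (M : List (Fin (n G))) → Unique M → Graph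
induced G M _ = record
  { n = length M
  ; E = λ a b → E G (lookup M a) (lookup M b)
  ; sym = λ a b → sym G (lookup M a) (lookup M b)
  ; irrefl = λ a → irrefl G (lookup M a)
  }

data ReachAvoiding (G : Graph) (M : List (Fin (n G))) : Fin (n G) → Fin (n G) → Set where
  here : ∀ {u} → u ∉ M → ReachAvoiding G M u u
  step : ∀ {u v w} → u ∉ M → Adj G u v → ReachAvoiding G M v w → ReachAvoiding G M u w

IsVertexCut : (G : Graph) → List (Fin (n G)) → Set
IsVertexCut G M = Σ (Fin (n G)) λ u → Σ (Fin (n G)) λ v →
  u ∉ M × v ∉ M × ¬ ReachAvoiding G M u v

PathAdj : (G : Graph) → List (Fin (n G)) → Set
PathAdj G [] = Data.Unit.⊤ where import Data.Unit
PathAdj G (x ∷ []) = Data.Unit.⊤ where import Data.Unit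
PathAdj G (x ∷ y ∷ xs) = Adj G x y × PathAdj G (y ∷ xs)

lastOr : ∀ {A : Set} → A → List A → A
lastOr d [] = d
lastOr d (x ∷ xs) = lastOr x xs

IsCycle : (G : Graph) → List (Fin (n G)) → Set
IsCycle G [] = ⊥
IsCycle G (v ∷ vs) = length (v ∷ vs) ≥ 3 × Unique (v ∷ vs) × PathAdj G (v ∷ vs) × Adj G (lastOr v vs) v

IsForest : Graph → Set
IsForest G = ¬ Σ (List (Fin (n G))) (IsCycle G)

IsBipartite : Graph → Set
IsBipartite G = Σ (Fin (n G) → Bool) λ c → ∀ i j → Adj G i j → ¬ (c i ≡ c j)

data Class : Set where
  𝔉 𝔅 : Class

_∈ᶜ_ : Graph → Class → Set
G ∈ᶜ 𝔉 = IsForest G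
G ∈ᶜ 𝔅 = IsBipartite G

IsΨCut : Class → (G : Graph) → (M : List (Fin (n G))) → Unique M → Set
IsΨCut Ψ G M u = IsVertexCut G M × (induced G M u ∈ᶜ Ψ)

HasΨCut : Class → Graph → Set
HasΨCut Ψ G = Σ (List (Fin (n G))) λ M → Σ (Unique M) λ u → IsΨCut Ψ G M u

Good : Class → ℚ → ℚ → Graph → Set
Good Ψ α β G = ∣ G ∣ᵥ ≥ 4 × 0ℚ < q α β G × ¬ HasΨCut Ψ G

InMinClass : Class → ℚ → ℚ → Graph → Set
InMinClass Ψ α β G = Good Ψ α β G × (∀ H → Good Ψ α β H → ∣ G ∣ᵥ Data.Nat.≤ ∣ H ∣ᵥ)

_≅_ : Graph → Graph → Set
G ≅ H = Σ (Fin (n G) ↔ Fin (n H)) λ f →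
  ∀ i j → (Adj G i j → Adj H (Inverse.to f i) (Inverse.to f j))
        × (Adj H (Inverse.to f i) (Inverse.to f j) → Adj G i j)

-- The diamond D = K₄ ∖ e : all pairs of distinct vertices of Fin 4 adjacent,
-- except the pair {0,1}.
open import Data.Fin using (zero; suc)
diamondE : Fin 4 → Fin 4 → Bool
diamondE zero zero = false
diamondE zero (suc zero) = false
diamondE zero (suc (suc _)) = true
diamondE (suc zero) zero = false
diamondE (suc zero) (suc zero) = false
diamondE (suc zero) (suc (suc _)) = true
diamondE (suc (suc _)) zero = true
diamondE (suc (suc _)) (suc zero) = true
diamondE (suc (suc zero)) (suc (suc zero)) = false
diamondE (suc (suc zero)) (suc (suc (suc zero))) = true
diamondE (suc (suc (suc zero))) (suc (suc zero)) = true
diamondE (suc (suc (suc zero))) (suc (suc (suc zero))) = false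

open import Relation.Binary.PropositionalEquality using (refl)
diamond : Graph
diamond = record { n = 4 ; E = diamondE ; sym = s ; irrefl = r }
  where
  s : ∀ i j → diamondE i j ≡ diamondE j i
  s zero zero = refl
  s zero (suc zero) = refl
  s zero (suc (suc zero)) = refl
  s zero (suc (suc (suc zero))) = refl
  s (suc zero) zero = refl
  s (suc zero) (suc zero) = refl
  s (suc zero) (suc (suc zero)) = refl
  s (suc zero) (suc (suc (suc zero))) = refl
  s (suc (suc zero)) zero = refl
  s (suc (suc zero)) (suc zero) = refl
  s (suc (suc zero)) (suc (suc zero)) = refl
  s (suc (suc zero)) (suc (suc (suc zero))) = refl
  s (suc (suc (suc zero))) zero = refl
  s (suc (suc (suc zero))) (suc zero) = refl
  s (suc (suc (suc zero))) (suc (suc zero)) = refl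
  s (suc (suc (suc zero))) (suc (suc (suc zero))) = refl
  r : ∀ i → diamondE i i ≡ false
  r zero = refl
  r (suc zero) = refl
  r (suc (suc zero)) = refl
  r (suc (suc (suc zero))) = refl

-- Let the diamond M = {a, b, c, d} (with a, b non-adjacent) cut G, let X be a component of G − M, and
-- split G into the sides G₁ = G[X ∪ M] and G₂ = G − X, which overlap exactly in M; let Hᵢ be Gᵢ plus the
-- edge ab. A Ψ-cut of Hᵢ lifts to a Ψ-cut of G, and so does a Ψ-cut of Gᵢ unless it contains c and d
-- and separates a from b: the vertices of M outside the cut stay connected inside the side (through c,
-- d or ab). Both Hᵢ are smaller than G, so minimality gives q(Hᵢ) ≤ 0. Since |H₁| + |H₂| = |G| + 4 and
-- e(H₁) + e(H₂) = e(G) + 7, the relation 4α − β = 6 yields q(H₁) + q(H₂) = q(G) − 1, hence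
-- q(Gᵢ) = q(Hᵢ) + 1 = q(G) − q(H₃₋ᵢ) > 0, and minimality forces each Gᵢ to have a Ψ-cut separating a
-- from b. Two forests (bipartite graphs) glued along a common edge form a forest (a bipartite graph), so
-- gluing the two cuts along cd gives a Ψ-cut of G separating a from b: a contradiction.

module Submission where

module Combinatorics where

  open import Defs renaming (sym to E-sym)
  open import Data.Nat using (ℕ; zero; suc; _+_; _≤_; _<_; _≥_; z≤n; s≤s; _<ᵇ_)
  open import Data.Nat.Properties
    using (*-cancelˡ-≡; +-comm; +-identityʳ; +-suc; +-mono-≤; ≤-refl; ≤-trans; <-irrefl; <-cmp; <ᵇ⇒<; <⇒<ᵇ; +-0-commutativeMonoid)
  open import Algebra.Properties.CommutativeMonoid.Sum +-0-commutativeMonoid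
    using (sum-syntax; ∑-distrib-+; ∑-comm; sum-cong-≗; sum-replicate-zero)
  open import Data.Bool using (Bool; true; false; _∧_; _∨_; _xor_; not; T; if_then_else_)
  open import Data.Bool.Properties using (xor-same; ∨-comm; ∧-comm; ∧-zeroʳ; ∨-identityʳ)
  open import Data.Nat.Solver using (module +-*-Solver)
  open +-*-Solver using (solve; _:+_; con; _:=_)
  open import Data.Fin using (Fin; toℕ; _≟_)
  open import Data.Fin.Patterns using (0F; 1F; 2F; 3F)
  open import Data.Fin.Properties using (toℕ-injective; suc-injective; any?; all?; ¬∀⟶∃¬)
  open import Data.List using (List; []; _∷_; [_]; _∷ʳ_; length; lookup; filterᵇ; allFin; cartesianProduct; map; _++_; tabulate)
  open import Data.List.Properties using (++-assoc; ++-identityʳ; length-map; length-++; filter-++; map-tabulate)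
  open import Data.List.Membership.Propositional using (_∈_; _∉_)
  open import Data.List.Membership.Propositional.Properties using (∈-∃++; ∈-lookup; ∈-allFin; ∈-filter⁺; ∈-filter⁻)
  open import Data.List.Relation.Unary.All using (All; []; _∷_)
  import Data.List.Relation.Unary.All as All
  import Data.List.Relation.Unary.All.Properties as All
  import Data.List.Relation.Unary.Any as Any
  open import Data.List.Relation.Unary.Any.Properties using (lookup-index)
  import Data.List.Relation.Unary.Unique.Propositional.Properties as Unique
  open import Data.List.Relation.Unary.AllPairs using ([]; _∷_)
  open import Data.List.Relation.Unary.Unique.Propositional using (Unique)
  open import Data.Product using (Σ; ∃; _×_; _,_; proj₁; proj₂)
  open import Data.Sum using (_⊎_; inj₁; inj₂; [_,_]′)
  import Data.Sum as Sum
  open import Data.Empty using (⊥; ⊥-elim)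
  open import Relation.Binary using (tri<; tri≈; tri>)
  open import Relation.Binary.PropositionalEquality using (_≡_; _≢_; refl; sym; trans; cong; cong₂; subst; subst₂; module ≡-Reasoning)
  open import Relation.Nullary using (¬_; Dec; yes; no)
  open import Relation.Nullary.Decidable using (T?; ¬?; ⌊_⌋; toWitness; fromWitness; _×-dec_; _→-dec_)
  open import Function using (_∘_)
  open import Function.Bundles using (Inverse)

  T⇒≡true : ∀ {b} → T b → b ≡ true
  T⇒≡true {true} _ = refl

  ¬T⇒≡false : ∀ {b} → ¬ T b → b ≡ false
  ¬T⇒≡false {true} ¬t = ⊥-elim (¬t _)
  ¬T⇒≡false {false} _ = refl

  T-∨ˡ : ∀ {a b} → T a → T (a ∨ b)
  T-∨ˡ {true} _ = _

  T-∨ʳ : ∀ a {b} → T b → T (a ∨ b)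
  T-∨ʳ true _ = _
  T-∨ʳ false t = t

  T-∨⁻ : ∀ a {b} → T (a ∨ b) → T a ⊎ T b
  T-∨⁻ true t = inj₁ t
  T-∨⁻ false t = inj₂ t

  T-∧ : ∀ {a b} → T a → T b → T (a ∧ b)
  T-∧ {true} _ t = t

  T-∧⁻ˡ : ∀ a {b} → T (a ∧ b) → T a
  T-∧⁻ˡ true _ = _

  T-∧⁻ʳ : ∀ a {b} → T (a ∧ b) → T b
  T-∧⁻ʳ true t = t

  T-not : ∀ {a} → ¬ T a → T (not a)
  T-not {true} ¬t = ¬t _
  T-not {false} _ = _

  T-not⁻ : ∀ {a} → T (not a) → ¬ T a
  T-not⁻ {true} () _

  T-not-not : ∀ {a} → ¬ T (not a) → T a
  T-not-not {true} _ = _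
  T-not-not {false} ¬t = ¬t _

  _==_ : ∀ {n} → Fin n → Fin n → Bool
  Fin.zero == Fin.zero = true
  Fin.zero == Fin.suc _ = false
  Fin.suc _ == Fin.zero = false
  Fin.suc x == Fin.suc y = x == y

  ==⇒≡ : ∀ {n} (x : Fin n) {y} → T (x == y) → x ≡ y
  ==⇒≡ Fin.zero {Fin.zero} _ = refl
  ==⇒≡ (Fin.suc x) {Fin.suc y} t = cong Fin.suc (==⇒≡ x t)

  ==-refl : ∀ {n} (x : Fin n) → T (x == x)
  ==-refl Fin.zero = _
  ==-refl (Fin.suc x) = ==-refl x

  xor-cancelʳ : ∀ a b t → a xor t ≡ b xor t → a ≡ b
  xor-cancelʳ false false _ _ = refl
  xor-cancelʳ true true _ _ = refl
  xor-cancelʳ false true false ()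
  xor-cancelʳ false true true ()
  xor-cancelʳ true false false ()
  xor-cancelʳ true false true ()

  ≢⇒xor≡true : ∀ {a b} → a ≢ b → a xor b ≡ true
  ≢⇒xor≡true {false} {false} a≢b = ⊥-elim (a≢b refl)
  ≢⇒xor≡true {false} {true} _ = refl
  ≢⇒xor≡true {true} {false} _ = refl
  ≢⇒xor≡true {true} {true} a≢b = ⊥-elim (a≢b refl)

  ⟦_⟧ : Bool → ℕ
  ⟦ true ⟧ = 1
  ⟦ false ⟧ = 0

  ⟦⟧≡if : ∀ b → ⟦ b ⟧ ≡ (if b then 1 else 0)
  ⟦⟧≡if true = refl
  ⟦⟧≡if false = refl

  ⟦⟧-mono : ∀ {a b} → (T a → T b) → ⟦ a ⟧ ≤ ⟦ b ⟧
  ⟦⟧-mono {false} _ = z≤n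
  ⟦⟧-mono {true} {true} _ = ≤-refl
  ⟦⟧-mono {true} {false} a⇒b = ⊥-elim (a⇒b _)

  if-0 : ∀ b → (if b then 0 else 0) ≡ 0
  if-0 true = refl
  if-0 false = refl

  if-+ : ∀ b m k → (if b then m + k else 0) ≡ (if b then m else 0) + (if b then k else 0)
  if-+ true m k = refl
  if-+ false m k = refl

  if-∑ : ∀ n b (f : Fin n → ℕ) → (if b then ∑[ y < n ] f y else 0) ≡ ∑[ y < n ] (if b then f y else 0)
  if-∑ n true f = refl
  if-∑ n false f = sym (sum-replicate-zero n)

  ∑-1 : ∀ n → ∑[ i < n ] 1 ≡ n
  ∑-1 zero = refl
  ∑-1 (suc n) = cong suc (∑-1 n)

  ∑-mono-≤ : ∀ n {f g : Fin n → ℕ} → (∀ i → f i ≤ g i) → ∑[ i < n ] f i ≤ ∑[ i < n ] g i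
  ∑-mono-≤ zero _ = z≤n
  ∑-mono-≤ (suc n) f≤g = +-mono-≤ (f≤g Fin.zero) (∑-mono-≤ n (f≤g ∘ Fin.suc))

  ∑-if-== : ∀ n (f : Fin n → ℕ) z → ∑[ y < n ] (if y == z then f y else 0) ≡ f z
  ∑-if-== (suc n) f Fin.zero = trans (cong (f Fin.zero +_) (sum-replicate-zero n)) (+-identityʳ _)
  ∑-if-== (suc n) f (Fin.suc z) = ∑-if-== n (f ∘ Fin.suc) z

  ∑∑-distrib-+ : ∀ n (f g : Fin n → Fin n → ℕ) →
    ∑[ x < n ] ∑[ y < n ] (f x y + g x y) ≡ ∑[ x < n ] ∑[ y < n ] f x y + ∑[ x < n ] ∑[ y < n ] g x y
  ∑∑-distrib-+ n f g = trans (sum-cong-≗ (λ x → ∑-distrib-+ (f x) (g x))) (∑-distrib-+ (λ x → ∑[ y < n ] f x y) _)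

  +-double-injective : ∀ m k → m + m ≡ k + k → m ≡ k
  +-double-injective m k eq = *-cancelˡ-≡ m k 2 (trans (cong (m +_) (+-identityʳ m)) (trans eq (sym (cong (k +_) (+-identityʳ k)))))

  count : ∀ {n} → (Fin n → Bool) → ℕ
  count {n} p = ∑[ x < n ] ⟦ p x ⟧

  count-mono : ∀ {n} {p q : Fin n → Bool} → (∀ x → T (p x) → T (q x)) → count p ≤ count q
  count-mono {n} p⊆q = ∑-mono-≤ n (λ x → ⟦⟧-mono (p⊆q x))

  count-≤ : ∀ {n} (p : Fin n → Bool) → count p ≤ n
  count-≤ {zero} p = z≤n
  count-≤ {suc n} p = +-mono-≤ (⟦⟧-mono {p Fin.zero} {true} _) (count-≤ (p ∘ Fin.suc))

  count-mono-< : ∀ {n} {p q : Fin n → Bool} → (∀ x → T (p x) → T (q x)) → ∀ y → T (q y) → ¬ T (p y) → count p < count q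
  count-mono-< {suc n} {p} {q} p⊆q Fin.zero qy ¬py with p Fin.zero | q Fin.zero
  ... | true | _ = ⊥-elim (¬py _)
  ... | false | true = s≤s (count-mono (p⊆q ∘ Fin.suc))
  count-mono-< {suc n} {p} {q} p⊆q (Fin.suc y) qy ¬py =
    subst (_≤ count q) (+-suc ⟦ p Fin.zero ⟧ _) (+-mono-≤ (⟦⟧-mono (p⊆q Fin.zero)) (count-mono-< (p⊆q ∘ Fin.suc) y qy ¬py))

  StableAt : ∀ {n} → (ℕ → Fin n → Bool) → ℕ → Set
  StableAt R k = ∀ x → T (R (suc k) x) → T (R k x)

  increasing-stabilises : ∀ {n} (R : ℕ → Fin n → Bool) → (∀ k x → T (R k x) → T (R (suc k) x)) → Σ ℕ (StableAt R)
  increasing-stabilises {n} R R-incr with grows (suc n)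
    where
    grows : ∀ k → Σ ℕ (StableAt R) ⊎ k ≤ count (R k)
    grows zero = inj₂ z≤n
    grows (suc k) with grows k
    ... | inj₁ stable = inj₁ stable
    ... | inj₂ k≤ with all? (λ x → T? (R (suc k) x) →-dec T? (R k x))
    ...   | yes stable = inj₁ (k , stable)
    ...   | no unstable with ¬∀⟶∃¬ n _ (λ x → T? (R (suc k) x) →-dec T? (R k x)) unstable
    ...     | y , ¬y⇒ with T? (R (suc k) y)
    ...       | yes Ry = inj₂ (≤-trans (s≤s k≤) (count-mono-< (R-incr k) y Ry (λ R′y → ¬y⇒ (λ _ → R′y))))
    ...       | no ¬Ry = ⊥-elim (¬y⇒ (λ Ry → ⊥-elim (¬Ry Ry)))
  ... | inj₁ stable = stable
  ... | inj₂ n<count = ⊥-elim (<-irrefl refl (≤-trans n<count (count-≤ (R (suc n)))))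

  ∑∑[_] : ∀ {N} → (Fin N → Bool) → (Fin N → Fin N → ℕ) → ℕ
  ∑∑[_] {N} P F = ∑[ x < N ] (if P x then ∑[ y < N ] (if P y then F x y else 0) else 0)

  ∑∑[]-as-double-sum : ∀ {N} (P : Fin N → Bool) F →
    ∑∑[ P ] F ≡ ∑[ x < N ] ∑[ y < N ] (if P x then (if P y then F x y else 0) else 0)
  ∑∑[]-as-double-sum {N} P F = sum-cong-≗ (λ x → if-∑ N (P x) _)

  ∑∑[]-cong : ∀ {N} (P : Fin N → Bool) {F F′ : Fin N → Fin N → ℕ} → (∀ x y → F x y ≡ F′ x y) → ∑∑[ P ] F ≡ ∑∑[ P ] F′
  ∑∑[]-cong {N} P F≗F′ =
    sum-cong-≗ (λ x → cong (λ k → if P x then k else 0) (sum-cong-≗ (λ y → cong (λ k → if P y then k else 0) (F≗F′ x y))))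

  ∑∑[]-distrib-+ : ∀ {N} (P : Fin N → Bool) (F F′ : Fin N → Fin N → ℕ) →
    ∑∑[ P ] (λ x y → F x y + F′ x y) ≡ ∑∑[ P ] F + ∑∑[ P ] F′
  ∑∑[]-distrib-+ {N} P F F′ = trans (sum-cong-≗ inner) (∑-distrib-+ (λ x → if P x then ∑[ y < N ] (if P y then F x y else 0) else 0) _)
    where
    inner : ∀ x → (if P x then ∑[ y < N ] (if P y then F x y + F′ x y else 0) else 0) ≡
                  (if P x then ∑[ y < N ] (if P y then F x y else 0) else 0) + (if P x then ∑[ y < N ] (if P y then F′ x y else 0) else 0)
    inner x = trans (cong (λ k → if P x then k else 0) (trans (sum-cong-≗ (λ y → if-+ (P y) (F x y) (F′ x y))) (∑-distrib-+ (λ y → if P y then F x y else 0) _)))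
                    (if-+ (P x) _ _)

  length-filterᵇ-tabulate : ∀ {A : Set} n (p : A → Bool) (f : Fin n → A) →
    length (filterᵇ p (tabulate f)) ≡ ∑[ i < n ] ⟦ p (f i) ⟧
  length-filterᵇ-tabulate zero p f = refl
  length-filterᵇ-tabulate (suc n) p f with p (f Fin.zero)
  ... | true = cong suc (length-filterᵇ-tabulate n p (f ∘ Fin.suc))
  ... | false = length-filterᵇ-tabulate n p (f ∘ Fin.suc)

  length-filterᵇ-cartesianProduct : ∀ {A B : Set} n m (p : A × B → Bool) (f : Fin n → A) (g : Fin m → B) →
    length (filterᵇ p (cartesianProduct (tabulate f) (tabulate g))) ≡ ∑[ i < n ] ∑[ j < m ] ⟦ p (f i , g j) ⟧
  length-filterᵇ-cartesianProduct zero m p f g = refl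
  length-filterᵇ-cartesianProduct (suc n) m p f g = begin
    length (filterᵇ p (row ++ rest))                      ≡⟨ cong length (filter-++ (T? ∘ p) row rest) ⟩
    length (filterᵇ p row ++ filterᵇ p rest)              ≡⟨ length-++ (filterᵇ p row) ⟩
    length (filterᵇ p row) + length (filterᵇ p rest)
      ≡⟨ cong₂ _+_ (trans (cong (length ∘ filterᵇ p) (map-tabulate g (f Fin.zero ,_))) (length-filterᵇ-tabulate m p _))
                   (length-filterᵇ-cartesianProduct n m p (f ∘ Fin.suc) g) ⟩
    _ ∎
    where
    open ≡-Reasoning
    row = map (f Fin.zero ,_) (tabulate g)
    rest = cartesianProduct (tabulate (f ∘ Fin.suc)) (tabulate g)

  e≡∑∑ : (G : Graph) → e G ≡ ∑[ i < n G ] ∑[ j < n G ] ⟦ (toℕ i <ᵇ toℕ j) ∧ E G i j ⟧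
  e≡∑∑ G = length-filterᵇ-cartesianProduct (n G) (n G) _ (λ i → i) (λ j → j)

  ≮⇒<ᵇ≡false : ∀ m k → ¬ m < k → (m <ᵇ k) ≡ false
  ≮⇒<ᵇ≡false m k m≮k = ¬T⇒≡false (m≮k ∘ <ᵇ⇒< m k)

  ⟦E⟧-split : ∀ (G : Graph) i j → ⟦ E G i j ⟧ ≡ ⟦ (toℕ i <ᵇ toℕ j) ∧ E G i j ⟧ + ⟦ (toℕ j <ᵇ toℕ i) ∧ E G j i ⟧
  ⟦E⟧-split G i j with <-cmp (toℕ i) (toℕ j)
  ... | tri< i<j _ j≮i rewrite T⇒≡true (<⇒<ᵇ i<j) | ≮⇒<ᵇ≡false _ _ j≮i = sym (+-identityʳ _)
  ... | tri> i≮j _ j<i rewrite T⇒≡true (<⇒<ᵇ j<i) | ≮⇒<ᵇ≡false _ _ i≮j | E-sym G j i = refl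
  ... | tri≈ i≮j i≡j _ rewrite toℕ-injective i≡j | irrefl G j | ≮⇒<ᵇ≡false _ _ i≮j = refl

  handshake : (G : Graph) → e G + e G ≡ ∑[ i < n G ] ∑[ j < n G ] ⟦ E G i j ⟧
  handshake G = begin
    e G + e G
      ≡⟨ cong₂ _+_ (e≡∑∑ G) (trans (e≡∑∑ G) (∑-comm forward)) ⟩
    ∑[ i < N ] ∑[ j < N ] forward i j + ∑[ i < N ] ∑[ j < N ] forward j i
      ≡⟨ sym (∑-distrib-+ (λ i → ∑[ j < N ] forward i j) _) ⟩
    ∑[ i < N ] (∑[ j < N ] forward i j + ∑[ j < N ] forward j i)
      ≡⟨ sum-cong-≗ (λ i → trans (sym (∑-distrib-+ (forward i) _)) (sum-cong-≗ (λ j → sym (⟦E⟧-split G i j)))) ⟩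
    ∑[ i < N ] ∑[ j < N ] ⟦ E G i j ⟧ ∎
    where
    open ≡-Reasoning
    N = n G
    forward : Fin N → Fin N → ℕ
    forward i j = ⟦ (toℕ i <ᵇ toℕ j) ∧ E G i j ⟧

  record Enumeration (n : ℕ) (P : Fin n → Bool) : Set where
    field
      size : ℕ
      elem : Fin size → Fin n
      elem-P : ∀ i → T (P (elem i))
      elem-injective : ∀ i j → elem i ≡ elem j → i ≡ j
      index : ∀ x → T (P x) → Fin size
      elem-index : ∀ x p → elem (index x p) ≡ x
      ∑-elem : ∀ (f : Fin n → ℕ) → ∑[ i < size ] f (elem i) ≡ ∑[ x < n ] (if P x then f x else 0)

    index-unique : ∀ x p i → elem i ≡ x → i ≡ index x p
    index-unique x p i eq = elem-injective i (index x p) (trans eq (sym (elem-index x p)))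

  enumerate : ∀ n (P : Fin n → Bool) → Enumeration n P
  enumerate zero P = record
    { size = 0 ; elem = λ () ; elem-P = λ () ; elem-injective = λ () ; index = λ () ; elem-index = λ () ; ∑-elem = λ _ → refl }
  enumerate (suc n) P with enumerate n (P ∘ Fin.suc) | P Fin.zero in P0
  ... | R | true = record
    { size = suc size
    ; elem = λ { Fin.zero → Fin.zero ; (Fin.suc i) → Fin.suc (elem i) }
    ; elem-P = λ { Fin.zero → subst T (sym P0) _ ; (Fin.suc i) → elem-P i }
    ; elem-injective = λ { Fin.zero Fin.zero _ → refl
                         ; (Fin.suc i) (Fin.suc j) eq → cong Fin.suc (elem-injective i j (suc-injective eq)) }
    ; index = λ { Fin.zero _ → Fin.zero ; (Fin.suc x) p → Fin.suc (index x p) }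
    ; elem-index = λ { Fin.zero _ → refl ; (Fin.suc x) p → cong Fin.suc (elem-index x p) }
    ; ∑-elem = λ f → cong₂ _+_ (cong (λ b → if b then f Fin.zero else 0) (sym P0)) (∑-elem (f ∘ Fin.suc))
    }
    where open Enumeration R
  ... | R | false = record
    { size = size
    ; elem = Fin.suc ∘ elem
    ; elem-P = elem-P
    ; elem-injective = λ i j eq → elem-injective i j (suc-injective eq)
    ; index = λ { Fin.zero p → ⊥-elim (subst T P0 p) ; (Fin.suc x) p → index x p }
    ; elem-index = λ { Fin.zero p → ⊥-elim (subst T P0 p) ; (Fin.suc x) p → cong Fin.suc (elem-index x p) }
    ; ∑-elem = λ f → trans (∑-elem (f ∘ Fin.suc)) (cong (_+ ∑[ x < n ] (if P (Fin.suc x) then f (Fin.suc x) else 0)) (cong (λ b → if b then f Fin.zero else 0) (sym P0)))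
    }
    where open Enumeration R

  inducedBy : (K : Graph) {P : Fin (n K) → Bool} → Enumeration (n K) P → Graph
  inducedBy K en = record
    { n = size ; E = λ i j → E K (elem i) (elem j) ; sym = λ i j → E-sym K (elem i) (elem j) ; irrefl = λ i → irrefl K (elem i) }
    where open Enumeration en

  size≡count : ∀ {N} {P : Fin N → Bool} (en : Enumeration N P) → Enumeration.size en ≡ count P
  size≡count {N} {P} en = begin
    size                                       ≡⟨ sym (∑-1 size) ⟩
    ∑[ i < size ] 1                            ≡⟨ ∑-elem (λ _ → 1) ⟩
    ∑[ x < N ] (if P x then 1 else 0)          ≡⟨ sum-cong-≗ (λ x → sym (⟦⟧≡if (P x))) ⟩
    count P ∎
    where
    open Enumeration en
    open ≡-Reasoning

  handshake-inducedBy : ∀ K {P} (en : Enumeration (n K) P) →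
    e (inducedBy K en) + e (inducedBy K en) ≡ ∑∑[ P ] (λ x y → ⟦ E K x y ⟧)
  handshake-inducedBy K en = trans (handshake (inducedBy K en))
    (trans (sum-cong-≗ (λ i → ∑-elem (λ y → ⟦ E K (elem i) y ⟧))) (∑-elem (λ x → ∑[ y < n K ] _)))
    where open Enumeration en

  -- Walks and components

  Adj-sym : ∀ G {u v} → Adj G u v → Adj G v u
  Adj-sym G {u} {v} = subst T (E-sym G u v)

  Adj-irrefl : ∀ G {u} → ¬ Adj G u u
  Adj-irrefl G {u} = subst T (irrefl G u)

  Adj⇒≢ : ∀ G {u v} → Adj G u v → u ≢ v
  Adj⇒≢ G uv refl = Adj-irrefl G uv

  data Walk (G : Graph) (A : Fin (n G) → Set) : Fin (n G) → Fin (n G) → Set where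
    here : ∀ {u} → A u → Walk G A u u
    step : ∀ {u v w} → A u → Adj G u v → Walk G A v w → Walk G A u w

  module _ {G : Graph} {A : Fin (n G) → Set} where

    walk-first : ∀ {x y} → Walk G A x y → A x
    walk-first (here a) = a
    walk-first (step a _ _) = a

    walk-last : ∀ {x y} → Walk G A x y → A y
    walk-last (here a) = a
    walk-last (step _ _ w) = walk-last w

    _++ʷ_ : ∀ {x y z} → Walk G A x y → Walk G A y z → Walk G A x z
    here _ ++ʷ w′ = w′
    step a xy w ++ʷ w′ = step a xy (w ++ʷ w′)

    walk-snoc : ∀ {x y z} → Walk G A x y → Adj G y z → A z → Walk G A x z
    walk-snoc w yz a = w ++ʷ step (walk-last w) yz (here a)

    walk-reverse : ∀ {x y} → Walk G A x y → Walk G A y x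
    walk-reverse (here a) = here a
    walk-reverse (step a xy w) = walk-snoc (walk-reverse w) (Adj-sym G xy) a

  walk-map : ∀ {G} {A B : Fin (n G) → Set} → (∀ {z} → A z → B z) → ∀ {x y} → Walk G A x y → Walk G B x y
  walk-map f (here a) = here (f a)
  walk-map f (step a xy w) = step (f a) xy (walk-map f w)

  ReachAvoiding⇒Walk : ∀ {G M x y} → ReachAvoiding G M x y → Walk G (_∉ M) x y
  ReachAvoiding⇒Walk (ReachAvoiding.here x∉M) = here x∉M
  ReachAvoiding⇒Walk (ReachAvoiding.step x∉M xy w) = step x∉M xy (ReachAvoiding⇒Walk w)

  Walk⇒ReachAvoiding : ∀ {G M x y} → Walk G (_∉ M) x y → ReachAvoiding G M x y
  Walk⇒ReachAvoiding (here x∉M) = ReachAvoiding.here x∉M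
  Walk⇒ReachAvoiding (step x∉M xy w) = ReachAvoiding.step x∉M xy (Walk⇒ReachAvoiding w)

  record Component (G : Graph) (A : Fin (n G) → Set) (u : Fin (n G)) : Set where
    field
      member : Fin (n G) → Bool
      root : T (member u)
      reach : ∀ {x} → T (member x) → Walk G A u x
      closed : ∀ {x y} → T (member x) → Adj G x y → A y → T (member y)

  component : ∀ G {A : Fin (n G) → Set} → (∀ x → Dec (A x)) → ∀ {u} → A u → Component G A u
  component G {A} A? {u} Au = record
    { member = within j
    ; root = within-root j
    ; reach = within-reach j
    ; closed = λ {x} {y} Xx xy Ay → stable y (T-∨ʳ (within j y) (fromWitness (Ay , (x , Xx , xy))))
    }
    where
    within : ℕ → Fin (n G) → Bool
    within zero x = x == u
    within (suc k) x = within k x ∨ ⌊ A? x ×-dec any? (λ y → T? (within k y) ×-dec T? (E G y x)) ⌋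

    within-root : ∀ k → T (within k u)
    within-root zero = ==-refl u
    within-root (suc k) = T-∨ˡ (within-root k)

    within-reach : ∀ k {x} → T (within k x) → Walk G A u x
    within-reach zero {x} x≡u with ==⇒≡ x x≡u
    ... | refl = here Au
    within-reach (suc k) {x} t with T-∨⁻ (within k x) t
    ... | inj₁ old = within-reach k old
    ... | inj₂ new with toWitness new
    ...   | Ax , (y , Wy , yx) = walk-snoc (within-reach k Wy) yx Ax

    stabilisation : Σ ℕ (StableAt within)
    stabilisation = increasing-stabilises within (λ k x → T-∨ˡ)

    j = proj₁ stabilisation
    stable = proj₂ stabilisation

  Unique⇒lookup-injective : ∀ {A : Set} (xs : List A) → Unique xs → ∀ i j → lookup xs i ≡ lookup xs j → i ≡ j
  Unique⇒lookup-injective (x ∷ xs) u Fin.zero Fin.zero eq = refl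
  Unique⇒lookup-injective (x ∷ xs) (x∉xs ∷ u) Fin.zero (Fin.suc j) eq = ⊥-elim (All.lookup x∉xs (∈-lookup j) eq)
  Unique⇒lookup-injective (x ∷ xs) (x∉xs ∷ u) (Fin.suc i) Fin.zero eq = ⊥-elim (All.lookup x∉xs (∈-lookup i) (sym eq))
  Unique⇒lookup-injective (x ∷ xs) (_ ∷ u) (Fin.suc i) (Fin.suc j) eq = cong Fin.suc (Unique⇒lookup-injective xs u i j eq)

  lastOr-map : ∀ {A B : Set} (f : A → B) v vs → lastOr (f v) (map f vs) ≡ f (lastOr v vs)
  lastOr-map f v [] = refl
  lastOr-map f v (x ∷ vs) = lastOr-map f x vs

  -- G restricted to the vertex set σ lies in Ψ, stated without building the induced graph.
  Induced∈ : Class → (G : Graph) → (Fin (n G) → Bool) → Set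
  Induced∈ 𝔉 G σ = ¬ Σ (List (Fin (n G))) λ L → IsCycle G L × All (T ∘ σ) L
  Induced∈ 𝔅 G σ = Σ (Fin (n G) → Bool) λ colour → ∀ {x y} → T (σ x) → T (σ y) → Adj G x y → colour x ≢ colour y

  module _ (G K : Graph) (g : Fin (n K) → Fin (n G)) where

    PathAdj-map⁻ : (∀ i j → Adj G (g i) (g j) → Adj K i j) → ∀ J → PathAdj G (map g J) → PathAdj K J
    PathAdj-map⁻ reflects [] _ = _
    PathAdj-map⁻ reflects (x ∷ []) _ = _
    PathAdj-map⁻ reflects (x ∷ y ∷ J) (xy , p) = reflects x y xy , PathAdj-map⁻ reflects (y ∷ J) p

    IsCycle-map⁻ : (∀ i j → Adj G (g i) (g j) → Adj K i j) → ∀ J → IsCycle G (map g J) → IsCycle K J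
    IsCycle-map⁻ reflects (v ∷ vs) (long , u , p , closing) =
      subst (_≥ 3) (length-map g (v ∷ vs)) long , Unique.map⁻ u , PathAdj-map⁻ reflects (v ∷ vs) p ,
      reflects _ _ (subst (λ z → Adj G z (g v)) (lastOr-map g v vs) closing)

    PathAdj-map⁺ : (∀ i j → Adj K i j → Adj G (g i) (g j)) → ∀ J → PathAdj K J → PathAdj G (map g J)
    PathAdj-map⁺ preserves [] _ = _
    PathAdj-map⁺ preserves (x ∷ []) _ = _
    PathAdj-map⁺ preserves (x ∷ y ∷ J) (xy , p) = preserves x y xy , PathAdj-map⁺ preserves (y ∷ J) p

    IsCycle-map⁺ : (∀ i j → g i ≡ g j → i ≡ j) → (∀ i j → Adj K i j → Adj G (g i) (g j)) →
      ∀ J → IsCycle K J → IsCycle G (map g J)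
    IsCycle-map⁺ injective preserves (v ∷ vs) (long , u , p , closing) =
      subst (_≥ 3) (sym (length-map g (v ∷ vs))) long , Unique.map⁺ (injective _ _) u , PathAdj-map⁺ preserves (v ∷ vs) p ,
      subst (λ z → Adj G z (g v)) (sym (lastOr-map g v vs)) (preserves _ _ closing)

  module Image (G K : Graph) (g : Fin (n K) → Fin (n G)) (reflects : ∀ i j → Adj G (g i) (g j) → Adj K i j) where

    image : Fin (n G) → Bool
    image x = ⌊ any? (λ i → g i ≟ x) ⌋

    image⁻ : ∀ {x} → T (image x) → ∃ λ i → g i ≡ x
    image⁻ = toWitness

    image⁺ : ∀ i → T (image (g i))
    image⁺ i = fromWitness (i , refl)

    All-image⇒map : ∀ L → All (T ∘ image) L → ∃ λ J → map g J ≡ L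
    All-image⇒map [] [] = [] , refl
    All-image⇒map (x ∷ L) (t ∷ ts) with image⁻ t | All-image⇒map L ts
    ... | i , refl | J , refl = i ∷ J , refl

    preimage-colour : (Fin (n K) → Bool) → Fin (n G) → Bool
    preimage-colour c x with any? (λ i → g i ≟ x)
    ... | yes (i , _) = c i
    ... | no _ = false

    preimage-colour-spec : ∀ c {x} → T (image x) → ∃ λ i → g i ≡ x × preimage-colour c x ≡ c i
    preimage-colour-spec c {x} t with any? (λ i → g i ≟ x)
    ... | yes (i , gi≡x) = i , gi≡x , refl

    Induced∈-image : ∀ Ψ → K ∈ᶜ Ψ → Induced∈ Ψ G image
    Induced∈-image 𝔉 forest (L , cycle , inImage) with All-image⇒map L inImage
    ... | J , refl = forest (J , IsCycle-map⁻ G K g reflects J cycle)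
    Induced∈-image 𝔅 (c , proper) = preimage-colour c , proper′
      where
      proper′ : ∀ {x y} → T (image x) → T (image y) → Adj G x y → preimage-colour c x ≢ preimage-colour c y
      proper′ tx ty xy eq with preimage-colour-spec c tx | preimage-colour-spec c ty
      ... | i , refl , ci | j , refl , cj = proper i j (reflects i j xy) (trans (sym ci) (trans eq cj))

  module _ (G : Graph) (σ : Fin (n G) → Bool) where

    members : List (Fin (n G))
    members = filterᵇ σ (allFin (n G))

    members-unique : Unique members
    members-unique = Unique.filter⁺ (T? ∘ σ) (Unique.allFin⁺ (n G))

    ∈-members⁺ : ∀ {x} → T (σ x) → x ∈ members
    ∈-members⁺ = ∈-filter⁺ (T? ∘ σ) (∈-allFin _)

    ∈-members⁻ : ∀ {x} → x ∈ members → T (σ x)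
    ∈-members⁻ = proj₂ ∘ ∈-filter⁻ (T? ∘ σ) {xs = allFin (n G)}

    induced-members∈ : ∀ Ψ → Induced∈ Ψ G σ → induced G members members-unique ∈ᶜ Ψ
    induced-members∈ 𝔉 acyclic (J , cycle) = acyclic
      ( map (lookup members) J
      , IsCycle-map⁺ G (induced G members members-unique) (lookup members)
          (Unique⇒lookup-injective members members-unique) (λ _ _ ij → ij) J cycle
      , All.map⁺ (All.tabulate (λ _ → ∈-members⁻ (∈-lookup _))) )
    induced-members∈ 𝔅 (colour , proper) = colour ∘ lookup members , λ i j ij → proper (∈-members⁻ (∈-lookup i)) (∈-members⁻ (∈-lookup j)) ij

    separation⇒HasΨCut : ∀ Ψ → Induced∈ Ψ G σ → ∀ {x y} → ¬ T (σ x) → ¬ T (σ y) → ¬ Walk G (¬_ ∘ T ∘ σ) x y → HasΨCut Ψ G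
    separation⇒HasΨCut Ψ inΨ {x} {y} ¬σx ¬σy disconnected =
      members , members-unique ,
      (x , y , ¬σx ∘ ∈-members⁻ , ¬σy ∘ ∈-members⁻ , disconnected ∘ walk-map (λ z∉ σz → z∉ (∈-members⁺ σz)) ∘ ReachAvoiding⇒Walk) ,
      induced-members∈ Ψ inΨ

  -- Gluing along an edge

  Unique-∷⇒∷ʳ : ∀ {A : Set} {x : A} xs → Unique (x ∷ xs) → Unique (xs ∷ʳ x)
  Unique-∷⇒∷ʳ [] _ = [] ∷ []
  Unique-∷⇒∷ʳ (y ∷ ys) ((x≢y ∷ x∉ys) ∷ (y∉ys ∷ u)) = All.++⁺ y∉ys ((x≢y ∘ sym) ∷ []) ∷ Unique-∷⇒∷ʳ ys (x∉ys ∷ u)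

  Unique-++⁻ˡ : ∀ {A : Set} (xs : List A) {ys} → Unique (xs ++ ys) → Unique xs
  Unique-++⁻ˡ [] _ = []
  Unique-++⁻ˡ (x ∷ xs) (x∉ ∷ u) = All.++⁻ˡ xs x∉ ∷ Unique-++⁻ˡ xs u

  Unique-++-∷⁻ : ∀ {A : Set} (B : List A) {x C} → Unique (B ++ x ∷ C) → All (_≢ x) B × All (x ≢_) C
  Unique-++-∷⁻ [] (x∉C ∷ _) = [] , x∉C
  Unique-++-∷⁻ (z ∷ B) (z∉ ∷ u) with Unique-++-∷⁻ B u | All.++⁻ʳ B z∉
  ... | B≢x , x∉C | z≢x ∷ _ = z≢x ∷ B≢x , x∉C

  lastOr-∷ʳ : ∀ {A : Set} (y : A) ys x → lastOr y (ys ∷ʳ x) ≡ x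
  lastOr-∷ʳ y [] x = refl
  lastOr-∷ʳ y (z ∷ zs) x = lastOr-∷ʳ z zs x

  length-∷ʳ : ∀ {A : Set} (xs : List A) x → length (xs ∷ʳ x) ≡ suc (length xs)
  length-∷ʳ xs x = trans (length-++ xs) (+-comm (length xs) 1)

  module _ (G : Graph) where

    PathAdj-tail : ∀ x xs → PathAdj G (x ∷ xs) → PathAdj G xs
    PathAdj-tail x [] _ = _
    PathAdj-tail x (y ∷ xs) (_ , p) = p

    PathAdj-++⁻ˡ : ∀ xs {ys} → PathAdj G (xs ++ ys) → PathAdj G xs
    PathAdj-++⁻ˡ [] _ = _
    PathAdj-++⁻ˡ (x ∷ []) _ = _
    PathAdj-++⁻ˡ (x ∷ y ∷ xs) (xy , p) = xy , PathAdj-++⁻ˡ (y ∷ xs) p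

    PathAdj-∷ʳ : ∀ y ys {x} → PathAdj G (y ∷ ys) → Adj G (lastOr y ys) x → PathAdj G (y ∷ ys ∷ʳ x)
    PathAdj-∷ʳ y [] _ yx = yx , _
    PathAdj-∷ʳ y (z ∷ zs) (yz , p) zx = yz , PathAdj-∷ʳ z zs p zx

    IsCycle-rotate₁ : ∀ x y ys → IsCycle G (x ∷ y ∷ ys) → IsCycle G (y ∷ ys ∷ʳ x)
    IsCycle-rotate₁ x y ys (long , u , (xy , p) , closing) =
      subst (_≥ 3) (sym (cong suc (length-∷ʳ ys x))) long ,
      Unique-∷⇒∷ʳ (y ∷ ys) u , PathAdj-∷ʳ y ys p closing ,
      subst (λ z → Adj G z y) (sym (lastOr-∷ʳ y ys x)) xy

    IsCycle-rotate : ∀ A k R → IsCycle G (A ++ k ∷ R) → IsCycle G (k ∷ R ++ A)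
    IsCycle-rotate [] k R cycle = subst (λ z → IsCycle G (k ∷ z)) (sym (++-identityʳ R)) cycle
    IsCycle-rotate (x ∷ []) k R cycle = IsCycle-rotate₁ x k R cycle
    IsCycle-rotate (x ∷ y ∷ A) k R cycle =
      subst (λ z → IsCycle G (k ∷ z)) (++-assoc R [ x ] (y ∷ A))
        (IsCycle-rotate (y ∷ A) k (R ∷ʳ x)
          (subst (λ z → IsCycle G (y ∷ z)) (++-assoc A (k ∷ R) [ x ]) (IsCycle-rotate₁ x y (A ++ k ∷ R) cycle)))

  All-rotate : ∀ {A : Set} {P : A → Set} xs k ys → All P (xs ++ k ∷ ys) → All P (k ∷ ys ++ xs)
  All-rotate xs k ys all with All.++⁻ xs all
  ... | Pxs , (Pk ∷ Pys) = Pk ∷ All.++⁺ Pys Pxs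

  module Gluing (G : Graph) {c d : Fin (n G)} (cd : Adj G c d) (τ₁ τ₂ : Fin (n G) → Bool)
    (c∈₁ : T (τ₁ c)) (d∈₁ : T (τ₁ d)) (c∈₂ : T (τ₂ c)) (d∈₂ : T (τ₂ d))
    (separated : ∀ {x y} → T (τ₁ x) → T (τ₂ y) → Adj G x y → (x ≡ c ⊎ x ≡ d) ⊎ (y ≡ c ⊎ y ≡ d)) where

    τ : Fin (n G) → Bool
    τ x = τ₁ x ∨ τ₂ x

    OnEdge : Fin (n G) → Set
    OnEdge z = z ≡ c ⊎ z ≡ d

    separated′ : ∀ {x y} → T (τ₂ x) → T (τ₁ y) → Adj G x y → OnEdge x ⊎ OnEdge y
    separated′ x∈₂ y∈₁ xy with separated y∈₁ x∈₂ (Adj-sym G xy)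
    ... | inj₁ p = inj₂ p
    ... | inj₂ p = inj₁ p

    OnEdge⇒τ₁ : ∀ {z} → OnEdge z → T (τ₁ z)
    OnEdge⇒τ₁ (inj₁ refl) = c∈₁
    OnEdge⇒τ₁ (inj₂ refl) = d∈₁

    OnEdge⇒τ₂ : ∀ {z} → OnEdge z → T (τ₂ z)
    OnEdge⇒τ₂ (inj₁ refl) = c∈₂
    OnEdge⇒τ₂ (inj₂ refl) = d∈₂

    path-one-side : ∀ L → PathAdj G L → All (T ∘ τ) L → All (¬_ ∘ OnEdge) L → All (T ∘ τ₁) L ⊎ All (T ∘ τ₂) L
    path-one-side [] _ _ _ = inj₁ []
    path-one-side (x ∷ []) _ (x∈ ∷ []) _ with T-∨⁻ (τ₁ x) x∈
    ... | inj₁ x∈₁ = inj₁ (x∈₁ ∷ [])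
    ... | inj₂ x∈₂ = inj₂ (x∈₂ ∷ [])
    path-one-side (x ∷ y ∷ L) (xy , p) (x∈ ∷ ∈s) (x∉ ∷ ∉s) with path-one-side (y ∷ L) p ∈s ∉s | T-∨⁻ (τ₁ x) x∈
    ... | inj₁ all₁ | inj₁ x∈₁ = inj₁ (x∈₁ ∷ all₁)
    ... | inj₂ all₂ | inj₂ x∈₂ = inj₂ (x∈₂ ∷ all₂)
    ... | inj₁ (y∈₁ ∷ _) | inj₂ x∈₂ = ⊥-elim ([ x∉ , All.head ∉s ]′ (separated′ x∈₂ y∈₁ xy))
    ... | inj₂ (y∈₂ ∷ _) | inj₁ x∈₁ = ⊥-elim ([ x∉ , All.head ∉s ]′ (separated x∈₁ y∈₂ xy))

    module _ (acyclic₁ : Induced∈ 𝔉 G τ₁) (acyclic₂ : Induced∈ 𝔉 G τ₂) where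

      no-one-sided-cycle : ∀ {L} → IsCycle G L → All (T ∘ τ₁) L ⊎ All (T ∘ τ₂) L → ⊥
      no-one-sided-cycle cycle (inj₁ all₁) = acyclic₁ (_ , cycle , all₁)
      no-one-sided-cycle cycle (inj₂ all₂) = acyclic₂ (_ , cycle , all₂)

      add-OnEdge : ∀ {k L} → OnEdge k → All (T ∘ τ₁) L ⊎ All (T ∘ τ₂) L → All (T ∘ τ₁) (k ∷ L) ⊎ All (T ∘ τ₂) (k ∷ L)
      add-OnEdge k∈ = Sum.map (OnEdge⇒τ₁ k∈ ∷_) (OnEdge⇒τ₂ k∈ ∷_)

      -- Off the edge, a cycle through its end k splits into paths that cannot change side; if it also
      -- passes through the other end k′, its arc from k to k′ closes up with the edge k′k to a cycle.
      module _ {k k′} (k∈ : OnEdge k) (k′∈ : OnEdge k′) (edge : ∀ {z} → OnEdge z → z ≡ k ⊎ z ≡ k′) (k′k : Adj G k′ k) where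

        off-edge : ∀ {z} → k ≢ z → z ≢ k′ → ¬ OnEdge z
        off-edge k≢z z≢k′ z∈ = [ k≢z ∘ sym , z≢k′ ]′ (edge z∈)

        short-cut : ∀ b B C → Unique (k ∷ b ∷ B ++ k′ ∷ C) → PathAdj G (k ∷ b ∷ B ++ k′ ∷ C) → IsCycle G (k ∷ b ∷ B ∷ʳ k′)
        short-cut b B C u p =
          subst (λ z → 3 ≤ suc (suc z)) (sym (length-∷ʳ B k′)) (s≤s (s≤s (s≤s z≤n))) ,
          Unique-++⁻ˡ (k ∷ b ∷ B ∷ʳ k′) (subst Unique reassoc u) ,
          PathAdj-++⁻ˡ G (k ∷ b ∷ B ∷ʳ k′) (subst (PathAdj G) reassoc p) ,
          subst (λ z → Adj G z k) (sym (lastOr-∷ʳ b B k′)) k′k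
          where
          reassoc : k ∷ b ∷ B ++ k′ ∷ C ≡ k ∷ b ∷ (B ∷ʳ k′) ++ C
          reassoc = cong (λ z → k ∷ b ∷ z) (sym (++-assoc B [ k′ ] C))

        no-cycle-through : ∀ B C → IsCycle G (k ∷ B ++ k′ ∷ C) → All (T ∘ τ) (B ++ k′ ∷ C) → ⊥
        no-cycle-through [] C cycle@(_ , ((_ ∷ k∉C) ∷ (k′∉C ∷ _)) , (_ , p) , _) (_ ∷ C∈) =
          no-one-sided-cycle cycle (add-OnEdge k∈ (add-OnEdge k′∈ (path-one-side C (PathAdj-tail G k′ C p) C∈
            (All.zipWith (λ (k≢z , k′≢z) → off-edge k≢z (k′≢z ∘ sym)) (k∉C , k′∉C)))))
        no-cycle-through (b ∷ B) C (_ , u@(k∉ ∷ uR) , p , _) ∈s =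
          no-one-sided-cycle (short-cut b B C u p) (Sum.map
            (λ all₁ → OnEdge⇒τ₁ k∈ ∷ All.++⁺ all₁ (OnEdge⇒τ₁ k′∈ ∷ []))
            (λ all₂ → OnEdge⇒τ₂ k∈ ∷ All.++⁺ all₂ (OnEdge⇒τ₂ k′∈ ∷ []))
            (path-one-side (b ∷ B) (PathAdj-tail G k (b ∷ B) (PathAdj-++⁻ˡ G (k ∷ b ∷ B) p)) (All.++⁻ˡ (b ∷ B) ∈s)
              (All.zipWith (λ (k≢z , z≢k′) → off-edge k≢z z≢k′) (All.++⁻ˡ (b ∷ B) k∉ , proj₁ (Unique-++-∷⁻ (b ∷ B) uR)))))

        no-cycle-from : ∀ R → IsCycle G (k ∷ R) → All (T ∘ τ) (k ∷ R) → ⊥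
        no-cycle-from R cycle@(_ , (k∉R ∷ _) , p , _) (_ ∷ R∈) with Any.any? (k′ ≟_) R
        ... | no k′∉R = no-one-sided-cycle cycle (add-OnEdge k∈ (path-one-side R (PathAdj-tail G k R p) R∈
              (All.zipWith (λ (k≢z , k′≢z) → off-edge k≢z (k′≢z ∘ sym)) (k∉R , All.¬Any⇒All¬ R k′∉R))))
        ... | yes k′∈R with ∈-∃++ k′∈R
        ...   | B , C , refl = no-cycle-through B C cycle R∈

      glue-acyclic : Induced∈ 𝔉 G τ
      glue-acyclic (L , cycle , L∈) with Any.any? (c ≟_) L | Any.any? (d ≟_) L
      ... | yes c∈L | _ with ∈-∃++ c∈L
      ...   | A , R , refl = no-cycle-from (inj₁ refl) (inj₂ refl) (λ z∈ → z∈) (Adj-sym G cd) (R ++ A)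
                               (IsCycle-rotate G A c R cycle) (All-rotate A c R L∈)
      glue-acyclic (L , cycle , L∈) | no _ | yes d∈L with ∈-∃++ d∈L
      ...   | A , R , refl = no-cycle-from (inj₂ refl) (inj₁ refl) Sum.swap cd (R ++ A)
                               (IsCycle-rotate G A d R cycle) (All-rotate A d R L∈)
      glue-acyclic (L , cycle , L∈) | no c∉L | no d∉L = no-one-sided-cycle cycle
        (path-one-side L (cycle-path L cycle) L∈
          (All.zipWith (λ (c≢z , d≢z) → [ c≢z ∘ sym , d≢z ∘ sym ]′) (All.¬Any⇒All¬ L c∉L , All.¬Any⇒All¬ L d∉L)))
        where
        cycle-path : ∀ L → IsCycle G L → PathAdj G L
        cycle-path (_ ∷ _) (_ , _ , p , _) = p

    glue-bipartite : Induced∈ 𝔅 G τ₁ → Induced∈ 𝔅 G τ₂ → Induced∈ 𝔅 G τ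
    glue-bipartite (c₁ , proper₁) (c₂ , proper₂) = colour , proper
      where
      colour : Fin (n G) → Bool
      -- Both colourings are normalised to give c the colour false; they then agree on d as well.
      colour x = if τ₁ x then c₁ x xor c₁ c else c₂ x xor c₂ c

      agree : ∀ {z} → OnEdge z → c₁ z xor c₁ c ≡ c₂ z xor c₂ c
      agree (inj₁ refl) = trans (xor-same (c₁ c)) (sym (xor-same (c₂ c)))
      agree (inj₂ refl) = trans (≢⇒xor≡true (proper₁ d∈₁ c∈₁ (Adj-sym G cd))) (sym (≢⇒xor≡true (proper₂ d∈₂ c∈₂ (Adj-sym G cd))))

      colour₁ : ∀ {x} → T (τ₁ x) → colour x ≡ c₁ x xor c₁ c
      colour₁ x∈₁ rewrite T⇒≡true x∈₁ = refl

      colour₂ : ∀ {x} → ¬ T (τ₁ x) → colour x ≡ c₂ x xor c₂ c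
      colour₂ x∉₁ rewrite ¬T⇒≡false x∉₁ = refl

      colour-OnEdge : ∀ {x} → OnEdge x → colour x ≡ c₂ x xor c₂ c
      colour-OnEdge x∈ = trans (colour₁ (OnEdge⇒τ₁ x∈)) (agree x∈)

      in₂ : ∀ {x} → T (τ x) → ¬ T (τ₁ x) → T (τ₂ x)
      in₂ {x} x∈ x∉₁ = [ ⊥-elim ∘ x∉₁ , (λ x∈₂ → x∈₂) ]′ (T-∨⁻ (τ₁ x) x∈)

      proper : ∀ {x y} → T (τ x) → T (τ y) → Adj G x y → colour x ≢ colour y
      proper {x} {y} x∈ y∈ xy eq with T? (τ₁ x) | T? (τ₁ y)
      ... | yes x∈₁ | yes y∈₁ = proper₁ x∈₁ y∈₁ xy (xor-cancelʳ _ _ (c₁ c) (trans (sym (colour₁ x∈₁)) (trans eq (colour₁ y∈₁))))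
      ... | no x∉₁ | no y∉₁ = proper₂ (in₂ x∈ x∉₁) (in₂ y∈ y∉₁) xy (xor-cancelʳ _ _ (c₂ c) (trans (sym (colour₂ x∉₁)) (trans eq (colour₂ y∉₁))))
      ... | yes x∈₁ | no y∉₁ with separated x∈₁ (in₂ y∈ y∉₁) xy
      ...   | inj₂ y∈e = y∉₁ (OnEdge⇒τ₁ y∈e)
      ...   | inj₁ x∈e = proper₂ (OnEdge⇒τ₂ x∈e) (in₂ y∈ y∉₁) xy (xor-cancelʳ _ _ (c₂ c) (trans (sym (colour-OnEdge x∈e)) (trans eq (colour₂ y∉₁))))
      proper {x} {y} x∈ y∈ xy eq | no x∉₁ | yes y∈₁ with separated′ (in₂ x∈ x∉₁) y∈₁ xy
      ...   | inj₁ x∈e = x∉₁ (OnEdge⇒τ₁ x∈e)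
      ...   | inj₂ y∈e = proper₂ (in₂ x∈ x∉₁) (OnEdge⇒τ₂ y∈e) xy (xor-cancelʳ _ _ (c₂ c) (trans (sym (colour₂ x∉₁)) (trans eq (colour-OnEdge y∈e))))

    glue : ∀ Ψ → Induced∈ Ψ G τ₁ → Induced∈ Ψ G τ₂ → Induced∈ Ψ G τ
    glue 𝔉 = glue-acyclic
    glue 𝔅 = glue-bipartite

  -- Splitting at a diamond cut

  AtMostOne⁴ : Bool → Bool → Bool → Bool → Set
  AtMostOne⁴ p q r s = (T p → ¬ T q) × (T p → ¬ T r) × (T p → ¬ T s) × (T q → ¬ T r) × (T q → ¬ T s) × (T r → ¬ T s)

  if-∨⁴ : ∀ p q r s m → AtMostOne⁴ p q r s →
    (if p ∨ q ∨ r ∨ s then m else 0) ≡ (if p then m else 0) + ((if q then m else 0) + ((if r then m else 0) + (if s then m else 0)))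
  if-∨⁴ true true _ _ _ (pq , _) = ⊥-elim (pq _ _)
  if-∨⁴ true false true _ _ (_ , pr , _) = ⊥-elim (pr _ _)
  if-∨⁴ true false false true _ (_ , _ , ps , _) = ⊥-elim (ps _ _)
  if-∨⁴ true false false false m _ = sym (+-identityʳ m)
  if-∨⁴ false true true _ _ (_ , _ , _ , qr , _) = ⊥-elim (qr _ _)
  if-∨⁴ false true false true _ (_ , _ , _ , _ , qs , _) = ⊥-elim (qs _ _)
  if-∨⁴ false true false false m _ = sym (+-identityʳ m)
  if-∨⁴ false false true true _ (_ , _ , _ , _ , _ , rs) = ⊥-elim (rs _ _)
  if-∨⁴ false false true false m _ = sym (+-identityʳ m)
  if-∨⁴ false false false true _ _ = refl
  if-∨⁴ false false false false _ _ = refl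

  ⟦∨⟧-disjoint : ∀ p q → (T q → ¬ T p) → ⟦ p ∨ q ⟧ ≡ ⟦ p ⟧ + ⟦ q ⟧
  ⟦∨⟧-disjoint true true disjoint = ⊥-elim (disjoint _ _)
  ⟦∨⟧-disjoint true false _ = refl
  ⟦∨⟧-disjoint false q _ = refl

  if-⟦⟧+⟦⟧ : ∀ P p q → (T p → T P) → (T q → T P) → ¬ (T p × T q) →
    (if P then ⟦ p ⟧ + ⟦ q ⟧ else 0) ≡ (if p then 1 else 0) + (if q then 1 else 0)
  if-⟦⟧+⟦⟧ _ true true _ _ both = ⊥-elim (both _)
  if-⟦⟧+⟦⟧ true true false _ _ _ = refl
  if-⟦⟧+⟦⟧ true false q _ _ _ = ⟦⟧≡if q
  if-⟦⟧+⟦⟧ false true false p⇒P _ _ = ⊥-elim (p⇒P _)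
  if-⟦⟧+⟦⟧ false false true _ q⇒P _ = ⊥-elim (q⇒P _)
  if-⟦⟧+⟦⟧ false false false _ _ _ = refl

  if-⟦∧∨∧⟧ : ∀ P xa xb yb ya → (T yb → T P) → (T ya → T P) → ¬ (T yb × T ya) → ¬ (T xa × T xb) →
    (if P then ⟦ (xa ∧ yb) ∨ (xb ∧ ya) ⟧ else 0) ≡ (if yb then ⟦ xa ⟧ else 0) + (if ya then ⟦ xb ⟧ else 0)
  if-⟦∧∨∧⟧ _ _ _ true true _ _ both _ = ⊥-elim (both _)
  if-⟦∧∨∧⟧ _ true true _ _ _ _ _ both = ⊥-elim (both _)
  if-⟦∧∨∧⟧ false _ _ true false yb⇒P _ _ _ = ⊥-elim (yb⇒P _)
  if-⟦∧∨∧⟧ false _ _ false true _ ya⇒P _ _ = ⊥-elim (ya⇒P _)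
  if-⟦∧∨∧⟧ false _ _ false false _ _ _ _ = refl
  if-⟦∧∨∧⟧ true true false true false _ _ _ _ = refl
  if-⟦∧∨∧⟧ true true false false true _ _ _ _ = refl
  if-⟦∧∨∧⟧ true true false false false _ _ _ _ = refl
  if-⟦∧∨∧⟧ true false true true false _ _ _ _ = refl
  if-⟦∧∨∧⟧ true false true false true _ _ _ _ = refl
  if-⟦∧∨∧⟧ true false true false false _ _ _ _ = refl
  if-⟦∧∨∧⟧ true false false true false _ _ _ _ = refl
  if-⟦∧∨∧⟧ true false false false true _ _ _ _ = refl
  if-⟦∧∨∧⟧ true false false false false _ _ _ _ = refl

  sides-vertex-count : ∀ A B → (T A → ¬ T B) → ⟦ A ∨ B ⟧ + ⟦ not A ⟧ ≡ 1 + ⟦ B ⟧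
  sides-vertex-count true true disjoint = ⊥-elim (disjoint _ _)
  sides-vertex-count true false _ = refl
  sides-vertex-count false true _ = refl
  sides-vertex-count false false _ = refl

  -- With A, C for x, y ∈ X, B, D for x, y ∈ M and e for "xy is an edge": an edge lies in both sides
  -- X ∪ M and V ∖ X when both ends are in M, and in exactly one of them otherwise.
  sides-edge-count : ∀ A B C D e → (T A → ¬ T B) → (T C → ¬ T D) → (T e → T A → ¬ T C → T D) → (T e → T C → ¬ T A → T B) →
    (if A ∨ B then (if C ∨ D then ⟦ e ⟧ else 0) else 0) + (if not A then (if not C then ⟦ e ⟧ else 0) else 0)
      ≡ ⟦ e ⟧ + (if B then (if D then ⟦ e ⟧ else 0) else 0)
  sides-edge-count A B C D false _ _ _ _ rewrite if-0 (C ∨ D) | if-0 (not C) | if-0 D | if-0 (A ∨ B) | if-0 (not A) | if-0 B = refl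
  sides-edge-count true true _ _ true AB _ _ _ = ⊥-elim (AB _ _)
  sides-edge-count _ _ true true true _ CD _ _ = ⊥-elim (CD _ _)
  sides-edge-count true false true false true _ _ _ _ = refl
  sides-edge-count true false false true true _ _ _ _ = refl
  sides-edge-count true false false false true _ _ A⇒D _ = ⊥-elim (A⇒D _ _ (λ ()))
  sides-edge-count false true true false true _ _ _ _ = refl
  sides-edge-count false true false true true _ _ _ _ = refl
  sides-edge-count false true false false true _ _ _ _ = refl
  sides-edge-count false false true false true _ _ _ C⇒B = ⊥-elim (C⇒B _ _ (λ ()))
  sides-edge-count false false false true true _ _ _ _ = refl
  sides-edge-count false false false false true _ _ _ _ = refl

  -- H is a side of the cut with the edge ab added, H⁻ the side itself.
  record Piece (Ψ : Class) (G : Graph) : Set where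
    field
      H H⁻ : Graph
      smaller : n H < n G
      large : n H ≥ 4
      same-vertices : n H⁻ ≡ n H
      one-more-edge : e H ≡ e H⁻ + 1
      no-cut : ¬ HasΨCut Ψ H

  record Splitting (Ψ : Class) (G : Graph) : Set where
    field
      piece₁ piece₂ : Piece Ψ G
    open Piece piece₁ public using () renaming (H to H₁; H⁻ to H₁⁻)
    open Piece piece₂ public using () renaming (H to H₂; H⁻ to H₂⁻)
    field
      vertices : n H₁ + n H₂ ≡ n G + 4
      edges : e H₁ + e H₂ ≡ e G + 7
      not-both-cut : HasΨCut Ψ H₁⁻ → HasΨCut Ψ H₂⁻ → ⊥

  diamondSet : ∀ {N} → Fin N → Fin N → Fin N → Fin N → Fin N → Bool
  diamondSet a b c d x = (x == a) ∨ (x == b) ∨ (x == c) ∨ (x == d)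

  module _ {N} (a b c d : Fin N) where

    diamondSet-cases : ∀ {x} → T (diamondSet a b c d x) → x ≡ a ⊎ x ≡ b ⊎ x ≡ c ⊎ x ≡ d
    diamondSet-cases {x} t =
      Sum.map (==⇒≡ x) (Sum.map (==⇒≡ x) (Sum.map (==⇒≡ x) (==⇒≡ x) ∘ T-∨⁻ (x == c)) ∘ T-∨⁻ (x == b)) (T-∨⁻ (x == a) t)

    a∈diamondSet : T (diamondSet a b c d a)
    a∈diamondSet = T-∨ˡ (==-refl a)

    b∈diamondSet : T (diamondSet a b c d b)
    b∈diamondSet = T-∨ʳ (b == a) (T-∨ˡ (==-refl b))

    c∈diamondSet : T (diamondSet a b c d c)
    c∈diamondSet = T-∨ʳ (c == a) (T-∨ʳ (c == b) (T-∨ˡ (==-refl c)))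

    d∈diamondSet : T (diamondSet a b c d d)
    d∈diamondSet = T-∨ʳ (d == a) (T-∨ʳ (d == b) (T-∨ʳ (d == c) (==-refl d)))

  module DiamondCut (G : Graph) {a b c d : Fin (n G)} (a≢b : a ≢ b)
    (a≁b : ¬ Adj G a b) (ac : Adj G a c) (ad : Adj G a d) (bc : Adj G b c) (bd : Adj G b d) (cd : Adj G c d)
    {u v : Fin (n G)} (u∉M : ¬ T (diamondSet a b c d u)) (v∉M : ¬ T (diamondSet a b c d v))
    (u↮v : ¬ Walk G (¬_ ∘ T ∘ diamondSet a b c d) u v) where

    N = n G

    M : Fin N → Bool
    M = diamondSet a b c d

    M-cases : ∀ {x} → T (M x) → x ≡ a ⊎ x ≡ b ⊎ x ≡ c ⊎ x ≡ d
    M-cases {x} = diamondSet-cases a b c d {x}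

    a∈M : T (M a)
    a∈M = a∈diamondSet a b c d
    b∈M : T (M b)
    b∈M = b∈diamondSet a b c d
    c∈M : T (M c)
    c∈M = c∈diamondSet a b c d
    d∈M : T (M d)
    d∈M = d∈diamondSet a b c d

    Outside : Fin N → Set
    Outside z = ¬ T (M z)

    Outside? : ∀ z → Dec (Outside z)
    Outside? z = ¬? (T? (M z))

    open Component (component G Outside? {u} u∉M) renaming (member to X; root to u∈X; closed to X-closed)

    X⊆Outside : ∀ {x} → T (X x) → Outside x
    X⊆Outside = walk-last ∘ reach

    v∉X : ¬ T (X v)
    v∉X = u↮v ∘ reach

    record Side : Set where
      field
        P : Fin N → Bool
        M⊆P : ∀ {x} → T (M x) → T (P x)
        leaves-through-M : ∀ {x y} → T (P x) → ¬ T (P y) → Adj G x y → T (M x)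
        outsider : Fin N
        outsider∉P : ¬ T (P outsider)

    side₁ : Side
    side₁ = record { P = λ x → X x ∨ M x ; M⊆P = λ {x} → T-∨ʳ (X x) ; leaves-through-M = leaves ; outsider = v ; outsider∉P = v∉ }
      where
      leaves : ∀ {x y} → T (X x ∨ M x) → ¬ T (X y ∨ M y) → Adj G x y → T (M x)
      leaves {x} {y} x∈ y∉ xy with T-∨⁻ (X x) x∈
      ... | inj₂ x∈M = x∈M
      ... | inj₁ x∈X = ⊥-elim (y∉ (T-∨ˡ (X-closed x∈X xy (y∉ ∘ T-∨ʳ (X y)))))
      v∉ : ¬ T (X v ∨ M v)
      v∉ t = [ v∉X , v∉M ]′ (T-∨⁻ (X v) t)

    side₂ : Side
    side₂ = record { P = not ∘ X ; M⊆P = M⊆ ; leaves-through-M = leaves ; outsider = u ; outsider∉P = u∉ }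
      where
      M⊆ : ∀ {x} → T (M x) → T (not (X x))
      M⊆ {x} x∈M = T-not (λ x∈X → X⊆Outside x∈X x∈M)
      leaves : ∀ {x y} → T (not (X x)) → ¬ T (not (X y)) → Adj G x y → T (M x)
      leaves {x} {y} x∉X y∈X xy with T? (M x)
      ... | yes x∈M = x∈M
      ... | no x∉M = ⊥-elim (T-not⁻ x∉X (X-closed (T-not-not y∈X) (Adj-sym G xy) x∉M))
      u∉ : ¬ T (not (X u))
      u∉ t = T-not⁻ t u∈X

    side₁∪side₂ : ∀ {y} → ¬ T (Side.P side₁ y) → T (Side.P side₂ y)
    side₁∪side₂ {y} y∉₁ = T-not (y∉₁ ∘ T-∨ˡ)

    side₂∪side₁ : ∀ {y} → ¬ T (Side.P side₂ y) → T (Side.P side₁ y)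
    side₂∪side₁ y∉₂ = T-∨ˡ (T-not-not y∉₂)

    isAB : Fin N → Fin N → Bool
    isAB x y = (x == a ∧ y == b) ∨ (x == b ∧ y == a)

    isAB-sym : ∀ x y → isAB x y ≡ isAB y x
    isAB-sym x y = trans (∨-comm (x == a ∧ y == b) _) (cong₂ _∨_ (∧-comm (x == b) _) (∧-comm (x == a) _))

    ¬isAB-refl : ∀ x → ¬ T (isAB x x)
    ¬isAB-refl x t with T-∨⁻ (x == a ∧ x == b) t
    ... | inj₁ t′ = a≢b (trans (sym (==⇒≡ x (T-∧⁻ˡ (x == a) t′))) (==⇒≡ x (T-∧⁻ʳ (x == a) t′)))
    ... | inj₂ t′ = a≢b (trans (sym (==⇒≡ x (T-∧⁻ʳ (x == b) t′))) (==⇒≡ x (T-∧⁻ˡ (x == b) t′)))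

    isAB⇒¬Adj : ∀ {x y} → T (isAB x y) → ¬ Adj G x y
    isAB⇒¬Adj {x} {y} t xy with T-∨⁻ (x == a ∧ y == b) t
    ... | inj₁ t′ = a≁b (subst₂ (Adj G) (==⇒≡ x (T-∧⁻ˡ (x == a) t′)) (==⇒≡ y (T-∧⁻ʳ (x == a) t′)) xy)
    ... | inj₂ t′ = a≁b (Adj-sym G (subst₂ (Adj G) (==⇒≡ x (T-∧⁻ˡ (x == b) t′)) (==⇒≡ y (T-∧⁻ʳ (x == b) t′)) xy))

    withAB : Bool → Graph
    withAB w = record
      { n = N
      ; E = λ x y → E G x y ∨ (w ∧ isAB x y)
      ; sym = λ x y → cong₂ _∨_ (E-sym G x y) (cong (w ∧_) (isAB-sym x y))
      ; irrefl = λ x → cong₂ _∨_ (irrefl G x) (∧-zeroʳ′ w (¬T⇒≡false (¬isAB-refl x)))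
      }
      where
      ∧-zeroʳ′ : ∀ w {t} → t ≡ false → w ∧ t ≡ false
      ∧-zeroʳ′ w refl = ∧-zeroʳ w

    G⊆withAB : ∀ w {x y} → Adj G x y → Adj (withAB w) x y
    G⊆withAB w = T-∨ˡ

    ab∈withAB : Adj (withAB true) a b
    ab∈withAB = T-∨ʳ (E G a b) (T-∨ˡ (T-∧ (==-refl a) (==-refl b)))

    M-adj-c : ∀ {x} → T (M x) → x ≢ c → Adj G x c
    M-adj-c {x} x∈M x≢c with M-cases {x} x∈M
    ... | inj₁ refl = ac
    ... | inj₂ (inj₁ refl) = bc
    ... | inj₂ (inj₂ (inj₁ refl)) = ⊥-elim (x≢c refl)
    ... | inj₂ (inj₂ (inj₂ refl)) = Adj-sym G cd

    M-adj-d : ∀ {x} → T (M x) → x ≢ d → Adj G x d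
    M-adj-d {x} x∈M x≢d with M-cases {x} x∈M
    ... | inj₁ refl = ad
    ... | inj₂ (inj₁ refl) = bd
    ... | inj₂ (inj₂ (inj₁ refl)) = cd
    ... | inj₂ (inj₂ (inj₂ refl)) = ⊥-elim (x≢d refl)

    module OnSide (s : Side) where
      open Side s public
      open Enumeration (enumerate N P) public

      sideGraph : Bool → Graph
      sideGraph w = inducedBy (withAB w) (enumerate N P)

      pa pb pc pd : Fin size
      pa = index a (M⊆P a∈M)
      pb = index b (M⊆P b∈M)
      pc = index c (M⊆P c∈M)
      pd = index d (M⊆P d∈M)

      elem-M-cases : ∀ {i} → T (M (elem i)) → i ≡ pa ⊎ i ≡ pb ⊎ i ≡ pc ⊎ i ≡ pd
      elem-M-cases {i} i∈M =
        Sum.map (index-unique a _ i) (Sum.map (index-unique b _ i) (Sum.map (index-unique c _ i) (index-unique d _ i))) (M-cases i∈M)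

      module CutTransfer (w : Bool) (Ψ : Class) (S : List (Fin size)) (uS : Unique S) where

        K : Graph
        K = induced (sideGraph w) S uS

        g : Fin (length S) → Fin N
        g = elem ∘ lookup S

        g-reflects : ∀ i j → Adj G (g i) (g j) → Adj K i j
        g-reflects i j = G⊆withAB w

        open Image G K g g-reflects public

        image⇒∈S : ∀ {i} → T (image (elem i)) → i ∈ S
        image⇒∈S {i} t with image⁻ t
        ... | j , gj≡ = subst (_∈ S) (elem-injective _ _ gj≡) (∈-lookup j)

        ∈S⇒image : ∀ {i} → i ∈ S → T (image (elem i))
        ∈S⇒image i∈S = subst (T ∘ image ∘ elem) (sym (lookup-index i∈S)) (image⁺ (Any.index i∈S))

        MConnected : Set
        MConnected = ∀ {i j} → T (M (elem i)) → T (M (elem j)) → i ∉ S → j ∉ S → Walk (sideGraph w) (_∉ S) i j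

        module _ (connected : MConnected) {q : Fin size} where

          -- A walk of G avoiding the image of S leaves the side through a vertex of M (detour) and
          -- re-enters through another; inside the side these two are joined by connected.
          mutual
            walk-back : ∀ {i x} → elem i ≡ x → Walk G (¬_ ∘ T ∘ image) x (elem q) → Walk (sideGraph w) (_∉ S) i q
            walk-back {i} eq (here ¬σx) = subst (λ z → Walk (sideGraph w) (_∉ S) z q) (sym (elem-injective i q eq)) (here (¬σx ∘ ∈S⇒image))
            walk-back {i} refl (step {v = y} ¬σx xy rest) with T? (P y)
            ... | yes y∈P = step (¬σx ∘ ∈S⇒image) (G⊆withAB w (subst (Adj G (elem i)) (sym (elem-index _ y∈P)) xy))
                              (walk-back (elem-index _ y∈P) rest)
            ... | no y∉P = detour (leaves-through-M (elem-P i) y∉P xy) (¬σx ∘ ∈S⇒image) y∉P rest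

            detour : ∀ {i y} → T (M (elem i)) → i ∉ S → ¬ T (P y) → Walk G (¬_ ∘ T ∘ image) y (elem q) → Walk (sideGraph w) (_∉ S) i q
            detour _ _ y∉P (here _) = ⊥-elim (y∉P (elem-P q))
            detour {i} {y} i∈M i∉S y∉P (step {v = z} _ yz rest) with T? (P z)
            ... | yes z∈P = connected i∈M (subst (T ∘ M) (sym (elem-index _ z∈P)) (leaves-through-M z∈P y∉P (Adj-sym G yz))) i∉S
                              (walk-first rest ∘ subst (T ∘ image) (elem-index _ z∈P) ∘ ∈S⇒image)
                            ++ʷ walk-back (elem-index _ z∈P) rest
            ... | no z∉P = detour i∈M i∉S z∉P rest

        transfer : IsΨCut Ψ (sideGraph w) S uS → MConnected → HasΨCut Ψ G
        transfer ((p , q , p∉S , q∉S , p↮q) , inΨ) connected =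
          separation⇒HasΨCut G image Ψ (Induced∈-image Ψ inΨ) (p∉S ∘ image⇒∈S) (q∉S ∘ image⇒∈S)
            (p↮q ∘ Walk⇒ReachAvoiding ∘ walk-back connected refl)

        MConnected-through : ∀ {z} (z∈M : T (M z)) → (∀ {x} → T (M x) → x ≢ z → Adj G x z) → index z (M⊆P z∈M) ∉ S → MConnected
        MConnected-through {z} z∈M adj-z pz∉S i∈M j∈M i∉S j∉S = to-z i∈M i∉S ++ʷ walk-reverse (to-z j∈M j∉S)
          where
          to-z : ∀ {i} → T (M (elem i)) → i ∉ S → Walk (sideGraph w) (_∉ S) i (index z (M⊆P z∈M))
          to-z {i} i∈M i∉S with i ≟ index z (M⊆P z∈M)
          ... | yes refl = here i∉S
          ... | no i≢pz = step i∉S (G⊆withAB w (subst (Adj G (elem i)) (sym (elem-index z _)) (adj-z i∈M (i≢pz ∘ index-unique z _ i))))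
                            (here pz∉S)

        MConnected-unless-cd∈S : (pc ∈ S → pd ∈ S → pa ∉ S → pb ∉ S → Walk (sideGraph w) (_∉ S) pa pb) → MConnected
        MConnected-unless-cd∈S a↝b {i} {j} i∈M j∈M i∉S j∉S with Any.any? (pc ≟_) S | Any.any? (pd ≟_) S
        ... | no pc∉S | _ = MConnected-through c∈M M-adj-c pc∉S i∈M j∈M i∉S j∉S
        ... | yes _ | no pd∉S = MConnected-through d∈M M-adj-d pd∉S i∈M j∈M i∉S j∉S
        ... | yes pc∈S | yes pd∈S with a-or-b i∈M i∉S | a-or-b j∈M j∉S
          where
          a-or-b : ∀ {k} → T (M (elem k)) → k ∉ S → k ≡ pa ⊎ k ≡ pb
          a-or-b {k} k∈M k∉S with elem-M-cases {k} k∈M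
          ... | inj₁ k≡pa = inj₁ k≡pa
          ... | inj₂ (inj₁ k≡pb) = inj₂ k≡pb
          ... | inj₂ (inj₂ (inj₁ refl)) = ⊥-elim (k∉S pc∈S)
          ... | inj₂ (inj₂ (inj₂ refl)) = ⊥-elim (k∉S pd∈S)
        ... | inj₁ refl | inj₁ refl = here i∉S
        ... | inj₁ refl | inj₂ refl = a↝b pc∈S pd∈S i∉S j∉S
        ... | inj₂ refl | inj₁ refl = walk-reverse (a↝b pc∈S pd∈S j∉S i∉S)
        ... | inj₂ refl | inj₂ refl = here i∉S

      record SeparatingCut (Ψ : Class) : Set where
        field
          S : List (Fin size)
          S-unique : Unique S
          inΨ : induced (sideGraph false) S S-unique ∈ᶜ Ψ
          pc∈S : pc ∈ S
          pd∈S : pd ∈ S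
          pa∉S : pa ∉ S
          pb∉S : pb ∉ S
          a↮b : ¬ Walk (sideGraph false) (_∉ S) pa pb

        open CutTransfer false Ψ S S-unique using (image; image⁻; image⇒∈S; ∈S⇒image; Induced∈-image)

        σ : Fin N → Bool
        σ = image

        elem-σ⁻ : ∀ {x} i → elem i ≡ x → T (σ x) → i ∈ S
        elem-σ⁻ i refl = image⇒∈S

        elem-σ⁺ : ∀ {x} i → elem i ≡ x → i ∈ S → T (σ x)
        elem-σ⁺ i refl = ∈S⇒image

        c∈σ : T (σ c)
        c∈σ = elem-σ⁺ pc (elem-index c _) pc∈S

        d∈σ : T (σ d)
        d∈σ = elem-σ⁺ pd (elem-index d _) pd∈S

        a∉σ : ¬ T (σ a)
        a∉σ = pa∉S ∘ elem-σ⁻ pa (elem-index a _)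

        b∉σ : ¬ T (σ b)
        b∉σ = pb∉S ∘ elem-σ⁻ pb (elem-index b _)

        σ⊆P : ∀ {x} → T (σ x) → T (P x)
        σ⊆P t with image⁻ t
        ... | i , refl = elem-P (lookup S i)

        σ∩M⊆cd : ∀ {x} → T (σ x) → T (M x) → x ≡ c ⊎ x ≡ d
        σ∩M⊆cd {x} x∈σ x∈M with M-cases {x} x∈M
        ... | inj₁ refl = ⊥-elim (a∉σ x∈σ)
        ... | inj₂ (inj₁ refl) = ⊥-elim (b∉σ x∈σ)
        ... | inj₂ (inj₂ x∈cd) = x∈cd

        σ∈Ψ : Induced∈ Ψ G σ
        σ∈Ψ = Induced∈-image Ψ inΨ

        ReachedFromA : Fin N → Set
        ReachedFromA x = ∃ λ i → elem i ≡ x × Walk (sideGraph false) (_∉ S) pa i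

        a-reached : ReachedFromA a
        a-reached = pa , elem-index a _ , here pa∉S

        b-unreached : ¬ ReachedFromA b
        b-unreached (i , eq , a↝i) = a↮b (subst (Walk (sideGraph false) (_∉ S) pa) (index-unique b _ i eq) a↝i)

        enter-from-a : ∀ {y} → T (P y) → Adj G a y → ¬ T (σ y) → ReachedFromA y
        enter-from-a {y} y∈P ay y∉σ = index y y∈P , elem-index y y∈P ,
          step pa∉S (G⊆withAB false (subst₂ (Adj G) (sym (elem-index a _)) (sym (elem-index y y∈P)) ay))
            (here (y∉σ ∘ elem-σ⁺ _ (elem-index y y∈P)))

    module WithoutΨCut (Ψ : Class) (noCut : ¬ HasΨCut Ψ G) where

      sideGraph-withAB-noCut : ∀ s → ¬ HasΨCut Ψ (OnSide.sideGraph s true)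
      sideGraph-withAB-noCut s (S , uS , cut) = noCut (transfer cut (MConnected-unless-cd∈S (λ _ _ pa∉S pb∉S → step pa∉S ab (here pb∉S))))
        where
        open OnSide s
        open CutTransfer true Ψ S uS
        ab : Adj (sideGraph true) pa pb
        ab = subst₂ (Adj (withAB true)) (sym (elem-index a _)) (sym (elem-index b _)) ab∈withAB

      separatingCut : ∀ s → HasΨCut Ψ (OnSide.sideGraph s false) → OnSide.SeparatingCut s Ψ
      separatingCut s (S , uS , cut) = record
        { S = S ; S-unique = uS ; inΨ = proj₂ cut
        ; pc∈S = decide-∈ pc (λ pc∉S → refute (λ pc∈S → ⊥-elim (pc∉S pc∈S)))
        ; pd∈S = decide-∈ pd (λ pd∉S → refute (λ _ pd∈S → ⊥-elim (pd∉S pd∈S)))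
        ; pa∉S = λ pa∈S → refute (λ _ _ pa∉S _ → ⊥-elim (pa∉S pa∈S))
        ; pb∉S = λ pb∈S → refute (λ _ _ _ pb∉S → ⊥-elim (pb∉S pb∈S))
        ; a↮b = λ a↝b → refute (λ _ _ _ _ → a↝b)
        }
        where
        open OnSide s
        open CutTransfer false Ψ S uS
        refute : (pc ∈ S → pd ∈ S → pa ∉ S → pb ∉ S → Walk (sideGraph false) (_∉ S) pa pb) → ⊥
        refute a↝b = noCut (transfer cut (MConnected-unless-cd∈S a↝b))
        decide-∈ : ∀ i → ¬ i ∉ S → i ∈ S
        decide-∈ i ¬i∉S with Any.any? (i ≟_) S
        ... | yes i∈S = i∈S
        ... | no i∉S = ⊥-elim (¬i∉S i∉S)

      module Crossing (s s′ : Side) (D : OnSide.SeparatingCut s Ψ) (D′ : OnSide.SeparatingCut s′ Ψ)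
        (covers : ∀ {y} → ¬ T (Side.P s y) → T (Side.P s′ y)) where
        module A = OnSide s
        module A′ = OnSide.SeparatingCut D
        module B′ = OnSide.SeparatingCut D′

        cross : ∀ {x y} → A′.ReachedFromA x → Adj G x y → ¬ T (A′.σ y) → ¬ T (B′.σ y) → A′.ReachedFromA y ⊎ B′.ReachedFromA y
        cross {y = y} (i , refl , a↝i) xy y∉σ y∉σ′ with T? (A.P y)
        ... | yes y∈P = inj₁ (A.index y y∈P , A.elem-index y y∈P ,
                walk-snoc a↝i (G⊆withAB false (subst (Adj G (A.elem i)) (sym (A.elem-index y y∈P)) xy))
                  (y∉σ ∘ A′.elem-σ⁺ _ (A.elem-index y y∈P)))
        ... | no y∉P with M-cases {A.elem i} (A.leaves-through-M (A.elem-P i) y∉P xy)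
        ...   | inj₁ elem≡a = inj₂ (B′.enter-from-a (covers y∉P) (subst (λ z → Adj G z y) elem≡a xy) y∉σ′)
        ...   | inj₂ (inj₁ elem≡b) = ⊥-elim (A′.b-unreached (i , elem≡b , a↝i))
        ...   | inj₂ (inj₂ (inj₁ elem≡c)) = ⊥-elim (walk-last a↝i (A′.elem-σ⁻ i elem≡c A′.c∈σ))
        ...   | inj₂ (inj₂ (inj₂ elem≡d)) = ⊥-elim (walk-last a↝i (A′.elem-σ⁻ i elem≡d A′.d∈σ))

      no-separating-cut-pair : OnSide.SeparatingCut side₁ Ψ → OnSide.SeparatingCut side₂ Ψ → ⊥
      no-separating-cut-pair D₁ D₂ = noCut (separation⇒HasΨCut G τ Ψ (glue Ψ D₁.σ∈Ψ D₂.σ∈Ψ) (avoids D₁.a∉σ D₂.a∉σ) (avoids D₁.b∉σ D₂.b∉σ) a↮b)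
        where
        module D₁ = OnSide.SeparatingCut D₁
        module D₂ = OnSide.SeparatingCut D₂
        module C₁₂ = Crossing side₁ side₂ D₁ D₂ side₁∪side₂
        module C₂₁ = Crossing side₂ side₁ D₂ D₁ side₂∪side₁

        separated : ∀ {x y} → T (D₁.σ x) → T (D₂.σ y) → Adj G x y → (x ≡ c ⊎ x ≡ d) ⊎ (y ≡ c ⊎ y ≡ d)
        separated {x} {y} x∈σ₁ y∈σ₂ xy with T? (M x) | T-∨⁻ (X x) (D₁.σ⊆P x∈σ₁)
        ... | yes x∈M | _ = inj₁ (D₁.σ∩M⊆cd x∈σ₁ x∈M)
        ... | no x∉M | inj₂ x∈M = ⊥-elim (x∉M x∈M)
        ... | no x∉M | inj₁ x∈X with T? (M y)
        ...   | yes y∈M = inj₂ (D₂.σ∩M⊆cd y∈σ₂ y∈M)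
        ...   | no y∉M = ⊥-elim (T-not⁻ (D₂.σ⊆P y∈σ₂) (X-closed x∈X xy y∉M))

        open Gluing G cd D₁.σ D₂.σ D₁.c∈σ D₁.d∈σ D₂.c∈σ D₂.d∈σ separated

        avoids : ∀ {z} → ¬ T (D₁.σ z) → ¬ T (D₂.σ z) → ¬ T (τ z)
        avoids {z} z∉σ₁ z∉σ₂ = [ z∉σ₁ , z∉σ₂ ]′ ∘ T-∨⁻ (D₁.σ z)

        reached : ∀ {x z} → Walk G (¬_ ∘ T ∘ τ) x z → D₁.ReachedFromA x ⊎ D₂.ReachedFromA x → D₁.ReachedFromA z ⊎ D₂.ReachedFromA z
        reached (here _) r = r
        reached (step {v = y} _ xy rest) (inj₁ r) = reached rest (C₁₂.cross r xy (walk-first rest ∘ T-∨ˡ) (walk-first rest ∘ T-∨ʳ (D₁.σ y)))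
        reached (step {v = y} _ xy rest) (inj₂ r) = reached rest (Sum.swap (C₂₁.cross r xy (walk-first rest ∘ T-∨ʳ (D₁.σ y)) (walk-first rest ∘ T-∨ˡ)))

        a↮b : ¬ Walk G (¬_ ∘ T ∘ τ) a b
        a↮b a↝b = [ D₁.b-unreached , D₂.b-unreached ]′ (reached a↝b (inj₁ D₁.a-reached))

    a≢c = Adj⇒≢ G ac
    a≢d = Adj⇒≢ G ad
    b≢c = Adj⇒≢ G bc
    b≢d = Adj⇒≢ G bd
    c≢d = Adj⇒≢ G cd

    M-at-most-once : ∀ x → AtMostOne⁴ (x == a) (x == b) (x == c) (x == d)
    M-at-most-once x =
      distinct a≢b , distinct a≢c , distinct a≢d , distinct b≢c , distinct b≢d , distinct c≢d
      where
      distinct : ∀ {y z} → y ≢ z → T (x == y) → ¬ T (x == z)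
      distinct y≢z x≡y x≡z = y≢z (trans (sym (==⇒≡ x x≡y)) (==⇒≡ x x≡z))

    ∑-over-M : ∀ (f : Fin N → ℕ) → ∑[ y < N ] (if M y then f y else 0) ≡ f a + (f b + (f c + f d))
    ∑-over-M f = begin
      ∑[ y < N ] (if M y then f y else 0)
        ≡⟨ sum-cong-≗ (λ y → if-∨⁴ _ _ _ _ (f y) (M-at-most-once y)) ⟩
      ∑[ y < N ] ((if y == a then f y else 0) + ((if y == b then f y else 0) + ((if y == c then f y else 0) + (if y == d then f y else 0))))
        ≡⟨ trans (∑-distrib-+ (λ y → if y == a then f y else 0) _) (cong₂ _+_ (∑-if-== N f a)
             (trans (∑-distrib-+ (λ y → if y == b then f y else 0) _) (cong₂ _+_ (∑-if-== N f b)
               (trans (∑-distrib-+ (λ y → if y == c then f y else 0) _) (cong₂ _+_ (∑-if-== N f c) (∑-if-== N f d)))))) ⟩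
      f a + (f b + (f c + f d)) ∎
      where open ≡-Reasoning

    count-M : count M ≡ 4
    count-M = trans (sum-cong-≗ (λ x → ⟦⟧≡if (M x))) (∑-over-M (λ _ → 1))

    ⟦E⟧ : Fin N → Fin N → ℕ
    ⟦E⟧ x y = ⟦ E G x y ⟧

    ∑∑[M]-edges : ∑∑[ M ] ⟦E⟧ ≡ 10
    ∑∑[M]-edges = begin
      ∑∑[ M ] ⟦E⟧
        ≡⟨ sum-cong-≗ (λ x → cong (λ k → if M x then k else 0) (∑-over-M (⟦E⟧ x))) ⟩
      ∑[ x < N ] (if M x then ⟦E⟧ x a + (⟦E⟧ x b + (⟦E⟧ x c + ⟦E⟧ x d)) else 0)
        ≡⟨ ∑-over-M (λ x → ⟦E⟧ x a + (⟦E⟧ x b + (⟦E⟧ x c + ⟦E⟧ x d))) ⟩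
      (⟦E⟧ a a + (⟦E⟧ a b + (⟦E⟧ a c + ⟦E⟧ a d))) + ((⟦E⟧ b a + (⟦E⟧ b b + (⟦E⟧ b c + ⟦E⟧ b d))) +
        ((⟦E⟧ c a + (⟦E⟧ c b + (⟦E⟧ c c + ⟦E⟧ c d))) + (⟦E⟧ d a + (⟦E⟧ d b + (⟦E⟧ d c + ⟦E⟧ d d)))))
        ≡⟨ diamond-entries ⟩
      10 ∎
      where
      open ≡-Reasoning
      diamond-entries : (⟦E⟧ a a + (⟦E⟧ a b + (⟦E⟧ a c + ⟦E⟧ a d))) + ((⟦E⟧ b a + (⟦E⟧ b b + (⟦E⟧ b c + ⟦E⟧ b d))) +
        ((⟦E⟧ c a + (⟦E⟧ c b + (⟦E⟧ c c + ⟦E⟧ c d))) + (⟦E⟧ d a + (⟦E⟧ d b + (⟦E⟧ d c + ⟦E⟧ d d))))) ≡ 10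
      diamond-entries
        rewrite irrefl G a | irrefl G b | irrefl G c | irrefl G d
              | ¬T⇒≡false a≁b | ¬T⇒≡false (a≁b ∘ Adj-sym G)
              | T⇒≡true ac | T⇒≡true (Adj-sym G ac) | T⇒≡true ad | T⇒≡true (Adj-sym G ad)
              | T⇒≡true bc | T⇒≡true (Adj-sym G bc) | T⇒≡true bd | T⇒≡true (Adj-sym G bd)
              | T⇒≡true cd | T⇒≡true (Adj-sym G cd) = refl

    module _ (s : Side) where
      open OnSide s

      size-sideGraph : ∀ w → n (sideGraph w) ≡ count P
      size-sideGraph w = size≡count (enumerate N P)

      size-sideGraph-< : ∀ w → n (sideGraph w) < N
      size-sideGraph-< w = subst (_< N) (sym (size-sideGraph w)) (≤-trans (count-mono-< {q = λ _ → true} (λ _ _ → _) outsider _ outsider∉P) (count-≤ {N} (λ _ → true)))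

      size-sideGraph-≥4 : ∀ w → n (sideGraph w) ≥ 4
      size-sideGraph-≥4 w = subst (4 ≤_) (sym (size-sideGraph w)) (subst (_≤ count P) count-M (count-mono {N} {M} {P} (λ _ → M⊆P)))

      ∑∑[]-isAB : ∑∑[ P ] (λ x y → ⟦ isAB x y ⟧) ≡ 2
      ∑∑[]-isAB = begin
        ∑∑[ P ] (λ x y → ⟦ isAB x y ⟧)
          ≡⟨ sum-cong-≗ (λ x → cong (λ k → if P x then k else 0) (row x)) ⟩
        ∑[ x < N ] (if P x then ⟦ x == a ⟧ + ⟦ x == b ⟧ else 0)
          ≡⟨ sum-cong-≗ (λ x → if-⟦⟧+⟦⟧ (P x) (x == a) (x == b) (at a∈M) (at b∈M) (λ (xa , xb) → a≢b (trans (sym (==⇒≡ x xa)) (==⇒≡ x xb)))) ⟩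
        ∑[ x < N ] ((if x == a then 1 else 0) + (if x == b then 1 else 0))
          ≡⟨ trans (∑-distrib-+ (λ x → if x == a then 1 else 0) _) (cong₂ _+_ (∑-if-== N _ a) (∑-if-== N _ b)) ⟩
        2 ∎
        where
        open ≡-Reasoning
        at : ∀ {z x} → T (M z) → T (x == z) → T (P x)
        at {z} {x} z∈M x≡z = subst (T ∘ P) (sym (==⇒≡ x x≡z)) (M⊆P z∈M)
        row : ∀ x → ∑[ y < N ] (if P y then ⟦ isAB x y ⟧ else 0) ≡ ⟦ x == a ⟧ + ⟦ x == b ⟧
        row x = begin
          ∑[ y < N ] (if P y then ⟦ isAB x y ⟧ else 0)
            ≡⟨ sum-cong-≗ (λ y → if-⟦∧∨∧⟧ (P y) (x == a) (x == b) (y == b) (y == a) (at b∈M) (at a∈M)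
                 (λ (yb , ya) → a≢b (trans (sym (==⇒≡ y ya)) (==⇒≡ y yb))) (λ (xa , xb) → a≢b (trans (sym (==⇒≡ x xa)) (==⇒≡ x xb)))) ⟩
          ∑[ y < N ] ((if y == b then ⟦ x == a ⟧ else 0) + (if y == a then ⟦ x == b ⟧ else 0))
            ≡⟨ trans (∑-distrib-+ (λ y → if y == b then ⟦ x == a ⟧ else 0) _) (cong₂ _+_ (∑-if-== N _ b) (∑-if-== N _ a)) ⟩
          ⟦ x == a ⟧ + ⟦ x == b ⟧ ∎

      ∑∑[]-withAB : ∀ w → ∑∑[ P ] (λ x y → ⟦ E (withAB w) x y ⟧) ≡ ∑∑[ P ] ⟦E⟧ + (if w then 2 else 0)
      ∑∑[]-withAB false = trans (∑∑[]-cong P (λ x y → cong ⟦_⟧ (∨-identityʳ (E G x y)))) (sym (+-identityʳ _))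
      ∑∑[]-withAB true = begin
        ∑∑[ P ] (λ x y → ⟦ E G x y ∨ isAB x y ⟧)
          ≡⟨ ∑∑[]-cong P (λ x y → ⟦∨⟧-disjoint (E G x y) (isAB x y) isAB⇒¬Adj) ⟩
        ∑∑[ P ] (λ x y → ⟦E⟧ x y + ⟦ isAB x y ⟧)
          ≡⟨ ∑∑[]-distrib-+ P ⟦E⟧ (λ x y → ⟦ isAB x y ⟧) ⟩
        ∑∑[ P ] ⟦E⟧ + ∑∑[ P ] (λ x y → ⟦ isAB x y ⟧)
          ≡⟨ cong (∑∑[ P ] ⟦E⟧ +_) ∑∑[]-isAB ⟩
        ∑∑[ P ] ⟦E⟧ + 2 ∎
        where open ≡-Reasoning

      e-sideGraph-withAB : e (sideGraph true) ≡ e (sideGraph false) + 1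
      e-sideGraph-withAB = +-double-injective _ _ (begin
        e (sideGraph true) + e (sideGraph true)    ≡⟨ handshake-inducedBy (withAB true) (enumerate N P) ⟩
        ∑∑[ P ] (λ x y → ⟦ E (withAB true) x y ⟧)   ≡⟨ ∑∑[]-withAB true ⟩
        ∑∑[ P ] ⟦E⟧ + 2                             ≡⟨ cong (_+ 2) (sym (trans (handshake-inducedBy (withAB false) (enumerate N P)) (trans (∑∑[]-withAB false) (+-identityʳ _)))) ⟩
        (e (sideGraph false) + e (sideGraph false)) + 2 ≡⟨ solve 1 (λ k → (k :+ k) :+ con 2 := (k :+ con 1) :+ (k :+ con 1)) refl (e (sideGraph false)) ⟩
        (e (sideGraph false) + 1) + (e (sideGraph false) + 1) ∎)
        where open ≡-Reasoning

    P₁ P₂ : Fin N → Bool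
    P₁ = Side.P side₁
    P₂ = Side.P side₂

    count-sides : count P₁ + count P₂ ≡ N + 4
    count-sides = begin
      count P₁ + count P₂                 ≡⟨ sym (∑-distrib-+ (λ x → ⟦ P₁ x ⟧) _) ⟩
      ∑[ x < N ] (⟦ P₁ x ⟧ + ⟦ P₂ x ⟧)    ≡⟨ sum-cong-≗ (λ x → sides-vertex-count (X x) (M x) X⊆Outside) ⟩
      ∑[ x < N ] (1 + ⟦ M x ⟧)            ≡⟨ ∑-distrib-+ {N} (λ _ → 1) (λ x → ⟦ M x ⟧) ⟩
      ∑[ x < N ] 1 + count M              ≡⟨ cong₂ _+_ (∑-1 N) count-M ⟩
      N + 4 ∎
      where open ≡-Reasoning

    edges-split : ∑∑[ P₁ ] ⟦E⟧ + ∑∑[ P₂ ] ⟦E⟧ ≡ (e G + e G) + ∑∑[ M ] ⟦E⟧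
    edges-split = begin
      ∑∑[ P₁ ] ⟦E⟧ + ∑∑[ P₂ ] ⟦E⟧
        ≡⟨ cong₂ _+_ (∑∑[]-as-double-sum P₁ ⟦E⟧) (∑∑[]-as-double-sum P₂ ⟦E⟧) ⟩
      ∑[ x < N ] ∑[ y < N ] side₁-term x y + ∑[ x < N ] ∑[ y < N ] side₂-term x y
        ≡⟨ sym (∑∑-distrib-+ N side₁-term side₂-term) ⟩
      ∑[ x < N ] ∑[ y < N ] (side₁-term x y + side₂-term x y)
        ≡⟨ sum-cong-≗ (λ x → sum-cong-≗ (λ y →
             sides-edge-count (X x) (M x) (X y) (M y) (E G x y) X⊆Outside X⊆Outside (crosses-into-M x y) (λ xy → crosses-into-M y x (Adj-sym G xy)))) ⟩
      ∑[ x < N ] ∑[ y < N ] (⟦E⟧ x y + (if M x then (if M y then ⟦E⟧ x y else 0) else 0))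
        ≡⟨ ∑∑-distrib-+ N ⟦E⟧ _ ⟩
      ∑[ x < N ] ∑[ y < N ] ⟦E⟧ x y + ∑[ x < N ] ∑[ y < N ] (if M x then (if M y then ⟦E⟧ x y else 0) else 0)
        ≡⟨ cong₂ _+_ (sym (handshake G)) (sym (∑∑[]-as-double-sum M ⟦E⟧)) ⟩
      (e G + e G) + ∑∑[ M ] ⟦E⟧ ∎
      where
      open ≡-Reasoning
      side₁-term side₂-term : Fin N → Fin N → ℕ
      side₁-term x y = if P₁ x then (if P₁ y then ⟦E⟧ x y else 0) else 0
      side₂-term x y = if P₂ x then (if P₂ y then ⟦E⟧ x y else 0) else 0
      crosses-into-M : ∀ x y → Adj G x y → T (X x) → ¬ T (X y) → T (M y)
      crosses-into-M x y xy x∈X y∉X with T? (M y)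
      ... | yes y∈M = y∈M
      ... | no y∉M = ⊥-elim (y∉X (X-closed x∈X xy y∉M))

    H₁ H₂ : Graph
    H₁ = OnSide.sideGraph side₁ true
    H₂ = OnSide.sideGraph side₂ true

    size-H₁+H₂ : n H₁ + n H₂ ≡ N + 4
    size-H₁+H₂ = trans (cong₂ _+_ (size-sideGraph side₁ true) (size-sideGraph side₂ true)) count-sides

    e-H₁+H₂ : e H₁ + e H₂ ≡ e G + 7
    e-H₁+H₂ = +-double-injective _ _ (begin
      (e H₁ + e H₂) + (e H₁ + e H₂)
        ≡⟨ solve 2 (λ h₁ h₂ → (h₁ :+ h₂) :+ (h₁ :+ h₂) := (h₁ :+ h₁) :+ (h₂ :+ h₂)) refl (e H₁) (e H₂) ⟩
      (e H₁ + e H₁) + (e H₂ + e H₂)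
        ≡⟨ cong₂ _+_ (doubled side₁) (doubled side₂) ⟩
      (∑∑[ P₁ ] ⟦E⟧ + 2) + (∑∑[ P₂ ] ⟦E⟧ + 2)
        ≡⟨ solve 2 (λ p₁ p₂ → (p₁ :+ con 2) :+ (p₂ :+ con 2) := (p₁ :+ p₂) :+ con 4) refl (∑∑[ P₁ ] ⟦E⟧) (∑∑[ P₂ ] ⟦E⟧) ⟩
      (∑∑[ P₁ ] ⟦E⟧ + ∑∑[ P₂ ] ⟦E⟧) + 4
        ≡⟨ cong (_+ 4) (trans edges-split (cong ((e G + e G) +_) ∑∑[M]-edges)) ⟩
      ((e G + e G) + 10) + 4
        ≡⟨ solve 1 (λ g → ((g :+ g) :+ con 10) :+ con 4 := (g :+ con 7) :+ (g :+ con 7)) refl (e G) ⟩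
      (e G + 7) + (e G + 7) ∎)
      where
      open ≡-Reasoning
      doubled : ∀ s → e (OnSide.sideGraph s true) + e (OnSide.sideGraph s true) ≡ ∑∑[ Side.P s ] ⟦E⟧ + 2
      doubled s = trans (handshake-inducedBy (withAB true) (enumerate N (Side.P s))) (∑∑[]-withAB s true)

    splitting : ∀ Ψ → ¬ HasΨCut Ψ G → Splitting Ψ G
    splitting Ψ noCut = record
      { piece₁ = piece side₁
      ; piece₂ = piece side₂
      ; vertices = size-H₁+H₂
      ; edges = e-H₁+H₂
      ; not-both-cut = λ cut₁ cut₂ → no-separating-cut-pair (separatingCut side₁ cut₁) (separatingCut side₂ cut₂)
      }
      where
      open WithoutΨCut Ψ noCut
      piece : Side → Piece Ψ G
      piece s = record
        { H = sideGraph true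
        ; H⁻ = sideGraph false
        ; smaller = size-sideGraph-< s true
        ; large = size-sideGraph-≥4 s true
        ; same-vertices = refl
        ; one-more-edge = e-sideGraph-withAB s
        ; no-cut = sideGraph-withAB-noCut s
        }
        where open OnSide s

  diamond-cut⇒splitting : ∀ Ψ (G : Graph) → ¬ HasΨCut Ψ G →
    ∀ M (uM : Unique M) → IsVertexCut G M → induced G M uM ≅ diamond → Splitting Ψ G
  diamond-cut⇒splitting Ψ G noCut M uM (u , v , u∉M , v∉M , u↮v) (f , iso) =
    DiamondCut.splitting G a≢b (nadj 0F 1F) (adj 0F 2F _) (adj 0F 3F _) (adj 1F 2F _) (adj 1F 3F _) (adj 2F 3F _)
      (u∉M ∘ diamondSet⊆M) (v∉M ∘ diamondSet⊆M) (u↮v ∘ Walk⇒ReachAvoiding ∘ walk-map (λ z∉ z∈M → z∉ (M⊆diamondSet z∈M)))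
      Ψ noCut
    where
    open Inverse f using (to; from; strictlyInverseˡ; strictlyInverseʳ)

    vertex : Fin 4 → Fin (n G)
    vertex x = lookup M (from x)

    a b c d : Fin (n G)
    a = vertex 0F
    b = vertex 1F
    c = vertex 2F
    d = vertex 3F

    adj : ∀ x y → Adj diamond x y → Adj G (vertex x) (vertex y)
    adj x y xy = proj₂ (iso (from x) (from y)) (subst₂ (Adj diamond) (sym (strictlyInverseˡ x)) (sym (strictlyInverseˡ y)) xy)

    nadj : ∀ x y → Adj G (vertex x) (vertex y) → Adj diamond x y
    nadj x y xy = subst₂ (Adj diamond) (strictlyInverseˡ x) (strictlyInverseˡ y) (proj₁ (iso (from x) (from y)) xy)

    a≢b : a ≢ b
    a≢b a≡b with trans (sym (strictlyInverseˡ 0F)) (trans (cong to (Unique⇒lookup-injective M uM (from 0F) (from 1F) a≡b)) (strictlyInverseˡ 1F))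
    ... | ()

    vertex∈diamondSet : ∀ x → T (diamondSet a b c d (vertex x))
    vertex∈diamondSet 0F = a∈diamondSet a b c d
    vertex∈diamondSet 1F = b∈diamondSet a b c d
    vertex∈diamondSet 2F = c∈diamondSet a b c d
    vertex∈diamondSet 3F = d∈diamondSet a b c d

    M⊆diamondSet : ∀ {z} → z ∈ M → T (diamondSet a b c d z)
    M⊆diamondSet z∈M = subst (T ∘ diamondSet a b c d) (trans (cong (lookup M) (strictlyInverseʳ _)) (sym (lookup-index z∈M)))
      (vertex∈diamondSet (to (Any.index z∈M)))

    diamondSet⊆M : ∀ {z} → T (diamondSet a b c d z) → z ∈ M
    diamondSet⊆M {z} z∈ with diamondSet-cases a b c d {z} z∈
    ... | inj₁ refl = ∈-lookup (from 0F)
    ... | inj₂ (inj₁ refl) = ∈-lookup (from 1F)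
    ... | inj₂ (inj₂ (inj₁ refl)) = ∈-lookup (from 2F)
    ... | inj₂ (inj₂ (inj₂ refl)) = ∈-lookup (from 3F)

open Combinatorics using (Piece; Splitting; diamond-cut⇒splitting)

open import Defs hiding (sym)
open import Data.Product using (Σ; _×_; _,_; proj₁; proj₂)
open import Data.List.Relation.Unary.Unique.Propositional using (Unique)
open import Data.Rational using (ℚ; _<_; _≤_; _*_; _-_; _/_; _+_; -_; 0ℚ; 1ℚ; mkℚ)
open import Data.Rational.Properties using (normalize-coprime; ≮⇒≥; +-mono-<-≤; neg-antimono-≤)
open import Data.Rational.Solver using (module +-*-Solver)
open +-*-Solver using (solve; _:+_; _:*_; _:-_; :-_; con; _:=_)
open import Data.Integer using (+_)
import Data.Integer as ℤ
import Data.Integer.Properties as ℤ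
open import Data.Nat using (_≥_)
import Data.Nat as ℕ
import Data.Nat.Properties as ℕ
import Data.Nat.Coprimality as Coprimality
open import Data.Empty using (⊥)
open import Relation.Binary.PropositionalEquality using (_≡_; refl; sym; trans; cong; cong₂; subst; module ≡-Reasoning)
open import Relation.Nullary using (¬_)

ℕ→ℚ≡mkℚ : ∀ m → ℕ→ℚ m ≡ mkℚ (+ m) 0 (Coprimality.sym (Coprimality.1-coprimeTo m))
ℕ→ℚ≡mkℚ m = normalize-coprime (Coprimality.sym (Coprimality.1-coprimeTo m))

ℕ→ℚ-+ : ∀ m k → ℕ→ℚ (m ℕ.+ k) ≡ ℕ→ℚ m + ℕ→ℚ k
ℕ→ℚ-+ m k rewrite ℕ→ℚ≡mkℚ m | ℕ→ℚ≡mkℚ k =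
  cong (_/ 1) (sym (cong₂ ℤ._+_ (ℤ.*-identityʳ (+ m)) (ℤ.*-identityʳ (+ k))))

q-one-more-edge : ∀ α β (H H⁻ : Graph) → n H⁻ ≡ n H → e H ≡ e H⁻ ℕ.+ 1 → q α β H⁻ ≡ q α β H + 1ℚ
q-one-more-edge α β H H⁻ same-n one-more = begin
  (α * ℕ→ℚ (n H⁻) - ℕ→ℚ (e H⁻)) - β
    ≡⟨ cong (λ k → (α * ℕ→ℚ k - ℕ→ℚ (e H⁻)) - β) same-n ⟩
  (α * ℕ→ℚ (n H) - ℕ→ℚ (e H⁻)) - β
    ≡⟨ solve 4 (λ α β N m → (α :* N :- m) :- β := ((α :* N :- (m :+ con 1ℚ)) :- β) :+ con 1ℚ) refl α β (ℕ→ℚ (n H)) (ℕ→ℚ (e H⁻)) ⟩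
  ((α * ℕ→ℚ (n H) - (ℕ→ℚ (e H⁻) + 1ℚ)) - β) + 1ℚ
    ≡⟨ cong (λ m → ((α * ℕ→ℚ (n H) - m) - β) + 1ℚ) (sym (trans (cong ℕ→ℚ one-more) (ℕ→ℚ-+ (e H⁻) 1))) ⟩
  q α β H + 1ℚ ∎
  where open ≡-Reasoning

q-split : ∀ α β (G H₁ H₂ : Graph) → n H₁ ℕ.+ n H₂ ≡ n G ℕ.+ 4 → e H₁ ℕ.+ e H₂ ≡ e G ℕ.+ 7 → (+ 4 / 1) * α - β ≡ (+ 6 / 1) →
  q α β H₁ + 1ℚ ≡ q α β G + (- q α β H₂)
q-split α β G H₁ H₂ vertices edges 4α-β≡6 = begin
  ((α * N₁ - E₁) - β) + 1ℚ
    ≡⟨ solve 6 (λ α β N₁ N₂ E₁ E₂ → ((α :* N₁ :- E₁) :- β) :+ con 1ℚ := ((α :* (N₁ :+ N₂) :- (E₁ :+ E₂)) :- (α :* N₂ :- E₂)) :- β :+ con 1ℚ)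
         refl α β N₁ N₂ E₁ E₂ ⟩
  ((α * (N₁ + N₂) - (E₁ + E₂)) - (α * N₂ - E₂)) - β + 1ℚ
    ≡⟨ cong₂ (λ x y → ((α * x - y) - (α * N₂ - E₂)) - β + 1ℚ)
         (trans (sym (ℕ→ℚ-+ (n H₁) (n H₂))) (trans (cong ℕ→ℚ vertices) (ℕ→ℚ-+ (n G) 4)))
         (trans (sym (ℕ→ℚ-+ (e H₁) (e H₂))) (trans (cong ℕ→ℚ edges) (ℕ→ℚ-+ (e G) 7))) ⟩
  ((α * (N + ℕ→ℚ 4) - (EG + ℕ→ℚ 7)) - (α * N₂ - E₂)) - β + 1ℚ
    ≡⟨ solve 6 (λ α β N EG N₂ E₂ → ((α :* (N :+ con (ℕ→ℚ 4)) :- (EG :+ con (ℕ→ℚ 7))) :- (α :* N₂ :- E₂)) :- β :+ con 1ℚ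
                                   := (((α :* N :- EG) :- β) :+ (:- ((α :* N₂ :- E₂) :- β))) :+ ((con (+ 4 / 1) :* α :- β) :- con (+ 6 / 1)))
         refl α β N EG N₂ E₂ ⟩
  (q α β G + (- q α β H₂)) + (((+ 4 / 1) * α - β) - (+ 6 / 1))
    ≡⟨ cong (λ z → (q α β G + (- q α β H₂)) + (z - (+ 6 / 1))) 4α-β≡6 ⟩
  (q α β G + (- q α β H₂)) + ((+ 6 / 1) - (+ 6 / 1))
    ≡⟨ solve 2 (λ x z → x :+ (z :- z) := x) refl (q α β G + (- q α β H₂)) (+ 6 / 1) ⟩
  q α β G + (- q α β H₂) ∎
  where
  open ≡-Reasoning
  N₁ = ℕ→ℚ (n H₁)
  N₂ = ℕ→ℚ (n H₂)
  N = ℕ→ℚ (n G)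
  E₁ = ℕ→ℚ (e H₁)
  E₂ = ℕ→ℚ (e H₂)
  EG = ℕ→ℚ (e G)

module _ (Ψ : Class) (α β : ℚ) {G : Graph} (minimal : InMinClass Ψ α β G) where

  smaller-not-good : ∀ H → n H ℕ.< n G → ¬ Good Ψ α β H
  smaller-not-good H smaller good = ℕ.<-irrefl refl (ℕ.≤-trans smaller (proj₂ minimal H good))

  module _ (P : Piece Ψ G) where
    open Piece P

    q-piece≤0 : q α β H ≤ 0ℚ
    q-piece≤0 = ≮⇒≥ (λ q>0 → smaller-not-good H smaller (large , q>0 , no-cut))

    piece⁻-has-cut : 0ℚ < q α β H⁻ → ¬ ¬ HasΨCut Ψ H⁻
    piece⁻-has-cut q>0 noCut = smaller-not-good H⁻ (subst (ℕ._< n G) (sym same-vertices) smaller)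
      (subst (_≥ 4) (sym same-vertices) large , q>0 , noCut)

  splitting-contradicts-minimality : (+ 4 / 1) * α - β ≡ (+ 6 / 1) → Splitting Ψ G → ⊥
  splitting-contradicts-minimality 4α-β≡6 split =
    piece⁻-has-cut piece₁ (q⁻>0 piece₁ piece₂ vertices edges) λ cut₁ →
    piece⁻-has-cut piece₂ (q⁻>0 piece₂ piece₁ (trans (ℕ.+-comm (n H₂) (n H₁)) vertices) (trans (ℕ.+-comm (e H₂) (e H₁)) edges)) λ cut₂ →
    not-both-cut cut₁ cut₂
    where
    open Splitting split
    q>0 : 0ℚ < q α β G
    q>0 = proj₁ (proj₂ (proj₁ minimal))
    q⁻>0 : ∀ P P′ → n (Piece.H P) ℕ.+ n (Piece.H P′) ≡ n G ℕ.+ 4 → e (Piece.H P) ℕ.+ e (Piece.H P′) ≡ e G ℕ.+ 7 → 0ℚ < q α β (Piece.H⁻ P)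
    q⁻>0 P P′ vertices′ edges′ =
      subst (0ℚ <_) (sym (trans (q-one-more-edge α β (Piece.H P) (Piece.H⁻ P) (Piece.same-vertices P) (Piece.one-more-edge P))
                                (q-split α β G (Piece.H P) (Piece.H P′) vertices′ edges′ 4α-β≡6)))
        (+-mono-<-≤ q>0 (neg-antimono-≤ (q-piece≤0 P′)))

lemma7 : (Ψ : Class) (α β : ℚ) →
    (+ 2 / 1) < α → α ≤ (+ 3 / 1) → (+ 4 / 1) * α - β ≡ (+ 6 / 1) →
    (G : Graph) → InMinClass Ψ α β G →
    ¬ (Σ _ λ M → Σ (Unique M) λ u → IsVertexCut G M × (induced G M u ≅ diamond))
lemma7 Ψ α β _ _ 4α-β≡6 G minimal (M , uM , cut , iso) =
  splitting-contradicts-minimality Ψ α β minimal 4α-β≡6 (diamond-cut⇒splitting Ψ G (proj₂ (proj₂ (proj₁ minimal))) M uM cut iso)
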